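{- Model checking \textsf{HyperMTL} is decidable when the model and the specification are both untimed: given a timed automaton $\mathcal{A}$ over $\Sigma_{AP}$ with no clocks and a closed \textsf{HyperMTL} formula $\phi$ over $AP$ (with arbitrary quantifier prefix) in which every constraining interval is $[0,\infty)$, it is decidable whether $[\![\mathcal{A}]\!]\models\phi$, and likewise whether $[\![\mathcal{A}]\!]\models^{\mathit{sync}}\phi$.
   Context: Fix a finite set $AP$ of atomic propositions and let $\Sigma_{AP}=2^{AP}$. A timed word (trace) over a finite alphabet $\Sigma$ is a finite sequence $\rho=(\sigma_1,\tau_1)\cdots(\sigma_n,\tau_n)$ with $\sigma_i\in\Sigma$, $\tau_i\in\mathbb{R}_{\ge 0}$ and $\tau_1<\dots<\tau_n$; write $t\in\rho$ iff $t=\tau_i$ for some $i$, and then $\rho(t)=\sigma_i$. $T\Sigma^\ast$ is the set of all timed words over $\Sigma$. A timed automaton (TA) over $\Sigma$ is $\langle\Sigma,S,s_0,X,\Delta,F\rangle$ with finite set of locations $S$, initial location $s_0$, finite set of clocks $X$, transitions $\Delta\subseteq S\times\Sigma\times G(X)\times2^X\times S$ and accepting locations $F\subseteq S$, where guards are generated by $g::=\top\mid g\wedge g\mid x\bowtie c$ with $\bowtie\in\{\le,<,\ge,>\}$, $x\in X$, $c\in\mathbb{N}$. A run on $(\sigma_1,\tau_1)\cdots(\sigma_n,\tau_n)$ is $(s_0,v_0)\cdots(s_n,v_n)$ with $v_0\equiv0$ and, for each $i<n$, a transition $(s_i,\sigma_{i+1},g,\lambda,s_{i+1})$ with $v_i+(\tau_{i+1}-\tau_i)\models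 g$ ($\tau_0=0$) and $v_{i+1}=(v_i+(\tau_{i+1}-\tau_i))[\lambda\leftarrow0]$; it is accepting if $s_n\in F$. $[\![\mathcal{A}]\!]$ is the set of timed words with an accepting run. A TA with $X=\emptyset$ is an (untimed) finite automaton; it accepts a timed word iff it accepts its untimed sequence of letters. \textsf{HyperMTL} syntax: with an infinite set $V$ of trace variables, formulae are $\phi::=\exists\pi\,\phi\mid\forall\pi\,\phi\mid\psi$ and $\psi::=\top\mid\top_\pi\mid p_\pi\mid\psi_1\wedge\psi_2\mid\neg\psi\mid\psi_1\,\mathbf{U}_I\,\psi_2\mid\psi_1\,\mathbf{S}_I\,\psi_2$, where $\pi\in V$, $p\in AP$, and $I\subseteq\mathbb{R}_{\ge0}$ is a non-singular interval with endpoints in $\mathbb{N}\cup\{\infty\}$; each quantifier binds a fresh variable; closed means no free trace variables. Derived: $\bot=\neg\top$, $\vee$, $\psi_1\widetilde{\mathbf{U}}_I\psi_2=\neg((\neg\psi_1)\mathbf{U}_I(\neg\psi_2))$, $\psi_1\widetilde{\mathbf{S}}_I\psi_2=\neg((\neg\psi_1)\mathbf{S}_I(\neg\psi_2))$. Asynchronous semantics: for $T\subseteq T\Sigma_{AP}^\ast$, a partial map $\Pi:V\to T\Sigma_{AP}^\ast$ and $t\ge0$: $(T,t)\models_\Pi\top$ iff $t\in\rho$ for some $\rho$ in the range of $\Pi$ ($\bot$ iff not); $\top_\pi$ iff $t\in\Pi(\pi)$ (its negation iff $t\notin\Pi(\pi)$); $p_\pi$ iff $t\in\Pi(\pi)$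 and $p\in\Pi(\pi)(t)$; $\neg p_\pi$ iff $t\in\Pi(\pi)$ and $p\notin\Pi(\pi)(t)$; $\wedge,\vee$ as usual; $\psi_1\mathbf{U}_I\psi_2$ at $t$ iff there is $t'>t$ with $t'-t\in I$, $\top$ and $\psi_2$ holding at $t'$, and $\psi_1$ holding at every $t''\in(t,t')$ at which $\top$ holds; $\psi_1\widetilde{\mathbf{U}}_I\psi_2$ at $t$ iff for every $t'>t$ with $t'-t\in I$ at which $\top$ holds, $\psi_2$ holds at $t'$ or $\psi_1$ holds at some $t''\in(t,t')$ at which $\top$ holds; $\mathbf{S}_I,\widetilde{\mathbf{S}}_I$ are the past mirrors; $\neg\psi$ is evaluated as the negation normal form of $\neg\psi$; $\exists\pi\,\phi$ iff $(T,t)\models_{\Pi[\pi\mapsto\rho]}\phi$ for some $\rho\in T$; $\forall\pi\,\phi$ iff for all $\rho\in T$. $T\models\phi$ iff $(T,0)\models_{\Pi_\emptyset}\phi$. Synchronous semantics $\models^{\mathit{sync}}$: identical, except each quantifier ranges only over those $\rho\in T$ whose set of timestamps equals the set of timestamps of every trace already in the range of $\Pi$.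
   Formalization: Timestamps of timed words, and the time points over which the semantics quantifies, are taken in the rationals instead of $\mathbb{R}_{\ge 0}$. -}

module Defs where

open import Data.Bool using (Bool; true; false)
open import Data.Nat as ℕ using (ℕ)
open import Data.Integer using (+_)
open import Data.Rational using (ℚ; 0ℚ; _≤_; _<_; _+_; _-_; _/_)
open import Data.Fin using (Fin)
open import Data.Vec using (Vec; lookup)
open import Data.List using (List; []; _∷_)
open import Data.List.Membership.Propositional using (_∈_; _∉_)
open import Data.List.Relation.Unary.All using (All)
open import Data.List.Relation.Unary.Any using (Any)
open import Data.Maybe using (Maybe; just; nothing)
open import Data.Product using (Σ; Σ-syntax; ∃; ∃-syntax; _×_; _,_; proj₁; proj₂)
open import Data.Sum using (_⊎_)
open import Data.Unit using (⊤)
open import Data.Empty using (⊥)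
open import Relation.Nullary using (¬_)
open import Relation.Binary.PropositionalEquality using (_≡_)

Time : Set
Time = ℚ

fromℕ : ℕ → ℚ
fromℕ c = + c / 1

-- Atomic propositions AP = Fin k ; Σ_AP = 2^AP as Vec Bool k

Letter : ℕ → Set
Letter k = Vec Bool k

data Increasing {A : Set} : List (A × ℚ) → Set where
  inc[]  : Increasing []
  inc[x] : ∀ {x} → Increasing (x ∷ [])
  inc∷   : ∀ {a b τ τ' ws} → τ < τ' → Increasing ((b , τ') ∷ ws) →
           Increasing ((a , τ) ∷ (b , τ') ∷ ws)

record TWord (A : Set) : Set where
  constructor tword
  field
    events     : List (A × ℚ)
    nonneg     : All (λ e → 0ℚ ≤ proj₂ e) events
    increasing : Increasing events
open TWord public

_∈T_ : ∀ {A} → ℚ → TWord A → Set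
t ∈T ρ = Any (λ e → proj₂ e ≡ t) (events ρ)

_at_≡_ : ∀ {A} → TWord A → ℚ → A → Set
ρ at t ≡ σ = (σ , t) ∈ events ρ

data Cmp : Set where
  le lt ge gt : Cmp

data Guard (n : ℕ) : Set where
  true-g : Guard n
  _∧g_   : Guard n → Guard n → Guard n
  atom   : Fin n → Cmp → ℕ → Guard n

Valuation : ℕ → Set
Valuation n = Fin n → ℚ

cmpHolds : Cmp → ℚ → ℚ → Set
cmpHolds le a b = a ≤ b
cmpHolds lt a b = a < b
cmpHolds ge a b = b ≤ a
cmpHolds gt a b = b < a

_⊨g_ : ∀ {n} → Valuation n → Guard n → Set
v ⊨g true-g      = ⊤
v ⊨g (g ∧g h)    = (v ⊨g g) × (v ⊨g h)
v ⊨g atom x ⋈ c  = cmpHolds ⋈ (v x) (fromℕ c)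

delay : ∀ {n} → Valuation n → ℚ → Valuation n
delay v d x = v x + d

reset : ∀ {n} → (Fin n → Bool) → Valuation n → Valuation n
reset r v x with r x
... | true  = 0ℚ
... | false = v x

record Transition (A : Set) (m n : ℕ) : Set where
  constructor trans
  field
    source : Fin m
    letter : A
    guard  : Guard n
    resets : Fin n → Bool
    target : Fin m

record TA (A : Set) (m n : ℕ) : Set where
  field
    initial   : Fin m
    Δ         : List (Transition A m n)
    accepting : Fin m → Bool
open TA public

-- runs from configuration (s, v) with previous timestamp τprev
data RunFrom {A : Set} {m n : ℕ} (𝒜 : TA A m n) :
       Fin m → Valuation n → ℚ → List (A × ℚ) → Set where
  done : ∀ {s v τ} → accepting 𝒜 s ≡ true → RunFrom 𝒜 s v τ []
  step : ∀ {s v τ σ τ' ws} (tr : Transition A m n) →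
         tr ∈ Δ 𝒜 →
         Transition.source tr ≡ s →
         Transition.letter tr ≡ σ →
         delay v (τ' - τ) ⊨g Transition.guard tr →
         RunFrom 𝒜 (Transition.target tr)
                   (reset (Transition.resets tr) (delay v (τ' - τ))) τ' ws →
         RunFrom 𝒜 s v τ ((σ , τ') ∷ ws)

⟦_⟧ : ∀ {A m n} → TA A m n → TWord A → Set
⟦ 𝒜 ⟧ ρ = RunFrom 𝒜 (initial 𝒜) (λ _ → 0ℚ) 0ℚ (events ρ)

data UpperBound : Set where
  ∞   : UpperBound
  fin : ℕ → Bool → UpperBound     -- bound, closed?

data NonSingular : ℕ → UpperBound → Set where
  ns∞   : ∀ {a} → NonSingular a ∞
  nsfin : ∀ {a b c} → a ℕ.< b → NonSingular a (fin b c)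

record Interval : Set where
  constructor interval
  field
    lower       : ℕ
    lowerClosed : Bool
    upper       : UpperBound
    nonSingular : NonSingular lower upper
open Interval public

_∈I_ : ℚ → Interval → Set
d ∈I I = lowOK (lowerClosed I) × upOK (upper I)
  where
  lowOK : Bool → Set
  lowOK true  = fromℕ (lower I) ≤ d
  lowOK false = fromℕ (lower I) < d
  upOK : UpperBound → Set
  upOK ∞             = ⊤
  upOK (fin b true)  = d ≤ fromℕ b
  upOK (fin b false) = d < fromℕ b

IsZeroInfty : Interval → Set
IsZeroInfty I = (lower I ≡ 0) × (lowerClosed I ≡ true) × (upper I ≡ ∞)

Var : Set
Var = ℕ

data QF (k : ℕ) : Set where
  true    : QF k
  true[_] : Var → QF k
  prop    : Fin k → Var → QF k
  _∧_     : QF k → QF k → QF k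
  ¬'_     : QF k → QF k
  _U[_]_  : QF k → Interval → QF k → QF k
  _S[_]_  : QF k → Interval → QF k → QF k

data HyperMTL (k : ℕ) : Set where
  Exists : Var → HyperMTL k → HyperMTL k
  Forall : Var → HyperMTL k → HyperMTL k
  body  : QF k → HyperMTL k

VarsIn : ∀ {k} → List Var → QF k → Set
VarsIn bs true          = ⊤
VarsIn bs true[ π ]     = π ∈ bs
VarsIn bs (prop p π)    = π ∈ bs
VarsIn bs (ψ ∧ ψ')      = VarsIn bs ψ × VarsIn bs ψ'
VarsIn bs (¬' ψ)        = VarsIn bs ψ
VarsIn bs (ψ U[ I ] ψ') = VarsIn bs ψ × VarsIn bs ψ'
VarsIn bs (ψ S[ I ] ψ') = VarsIn bs ψ × VarsIn bs ψ'

WellBound : ∀ {k} → List Var → HyperMTL k → Set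
WellBound bs (Exists π φ) = π ∉ bs × WellBound (π ∷ bs) φ
WellBound bs (Forall π φ) = π ∉ bs × WellBound (π ∷ bs) φ
WellBound bs (body ψ)   = VarsIn bs ψ

Closed : ∀ {k} → HyperMTL k → Set
Closed φ = WellBound [] φ

QFUntimed : ∀ {k} → QF k → Set
QFUntimed true          = ⊤
QFUntimed true[ π ]     = ⊤
QFUntimed (prop p π)    = ⊤
QFUntimed (ψ ∧ ψ')      = QFUntimed ψ × QFUntimed ψ'
QFUntimed (¬' ψ)        = QFUntimed ψ
QFUntimed (ψ U[ I ] ψ') = IsZeroInfty I × QFUntimed ψ × QFUntimed ψ'
QFUntimed (ψ S[ I ] ψ') = IsZeroInfty I × QFUntimed ψ × QFUntimed ψ'

Untimed : ∀ {k} → HyperMTL k → Set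
Untimed (Exists π φ) = Untimed φ
Untimed (Forall π φ) = Untimed φ
Untimed (body ψ)   = QFUntimed ψ

TW : ℕ → Set
TW k = TWord (Letter k)

Assignment : ℕ → Set
Assignment k = Var → Maybe (TW k)

Π∅ : ∀ {k} → Assignment k
Π∅ _ = nothing

_[_↦_] : ∀ {k} → Assignment k → Var → TW k → Assignment k
(Π [ π ↦ ρ ]) π' with π' ℕ.≟ π
... | Relation.Nullary.yes _ = just ρ
... | Relation.Nullary.no  _ = Π π'

InRange : ∀ {k} → Assignment k → TW k → Set
InRange Π ρ = ∃[ π ] (Π π ≡ just ρ)

-- ⊤ holds at t
Live : ∀ {k} → Assignment k → ℚ → Set
Live Π t = ∃[ ρ ] (InRange Π ρ × t ∈T ρ)

LiveAt : ∀ {k} → Assignment k → Var → ℚ → Set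
LiveAt Π π t = ∃[ ρ ] (Π π ≡ just ρ × t ∈T ρ)

PropAt : ∀ {k} → Assignment k → Fin k → Var → Bool → ℚ → Set
PropAt Π p π b t =
  ∃[ ρ ] (Π π ≡ just ρ × ∃[ σ ] ((ρ at t ≡ σ) × lookup σ p ≡ b))

-- Positive (Sat⁺) and negated, i.e. NNF of ¬ψ, (Sat⁻) satisfaction
mutual
  Sat⁺ : ∀ {k} → Assignment k → QF k → ℚ → Set
  Sat⁺ Π true t          = Live Π t
  Sat⁺ Π true[ π ] t     = LiveAt Π π t
  Sat⁺ Π (prop p π) t    = PropAt Π p π true t
  Sat⁺ Π (ψ ∧ ψ') t      = Sat⁺ Π ψ t × Sat⁺ Π ψ' t
  Sat⁺ Π (¬' ψ) t        = Sat⁻ Π ψ t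
  Sat⁺ Π (ψ U[ I ] ψ') t =
    ∃[ t' ] (t < t' × (t' - t) ∈I I × Live Π t' × Sat⁺ Π ψ' t' ×
             (∀ t'' → t < t'' → t'' < t' → Live Π t'' → Sat⁺ Π ψ t''))
  Sat⁺ Π (ψ S[ I ] ψ') t =
    ∃[ t' ] (t' < t × (t - t') ∈I I × Live Π t' × Sat⁺ Π ψ' t' ×
             (∀ t'' → t' < t'' → t'' < t → Live Π t'' → Sat⁺ Π ψ t''))

  Sat⁻ : ∀ {k} → Assignment k → QF k → ℚ → Set
  Sat⁻ Π true t          = ¬ Live Π t
  Sat⁻ Π true[ π ] t     = ¬ LiveAt Π π t
  Sat⁻ Π (prop p π) t    = PropAt Π p π false t
  Sat⁻ Π (ψ ∧ ψ') t      = Sat⁻ Π ψ t ⊎ Sat⁻ Π ψ' t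
  Sat⁻ Π (¬' ψ) t        = Sat⁺ Π ψ t
  Sat⁻ Π (ψ U[ I ] ψ') t =
    ∀ t' → t < t' → (t' - t) ∈I I → Live Π t' →
      Sat⁻ Π ψ' t' ⊎ ∃[ t'' ] (t < t'' × t'' < t' × Live Π t'' × Sat⁻ Π ψ t'')
  Sat⁻ Π (ψ S[ I ] ψ') t =
    ∀ t' → t' < t → (t - t') ∈I I → Live Π t' →
      Sat⁻ Π ψ' t' ⊎ ∃[ t'' ] (t' < t'' × t'' < t × Live Π t'' × Sat⁻ Π ψ t'')

SameStamps : ∀ {k} → TW k → TW k → Set
SameStamps ρ ρ' = ∀ t → (t ∈T ρ → t ∈T ρ') × (t ∈T ρ' → t ∈T ρ)

data Mode : Set where
  async sync : Mode

Admissible : ∀ {k} → Mode → Assignment k → TW k → Set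
Admissible async Π ρ = ⊤
Admissible sync  Π ρ = ∀ ρ' → InRange Π ρ' → SameStamps ρ ρ'

SatH : ∀ {k} → Mode → (TW k → Set) → Assignment k → HyperMTL k → ℚ → Set
SatH md T Π (Exists π φ) t = ∃[ ρ ] (T ρ × Admissible md Π ρ × SatH md T (Π [ π ↦ ρ ]) φ t)
SatH md T Π (Forall π φ) t = ∀ ρ → T ρ → Admissible md Π ρ → SatH md T (Π [ π ↦ ρ ]) φ t
SatH md T Π (body ψ)   t = Sat⁺ Π ψ t

_⊨_ : ∀ {k} → (TW k → Set) → HyperMTL k → Set
T ⊨ φ = SatH async T Π∅ φ 0ℚ

_⊨sync_ : ∀ {k} → (TW k → Set) → HyperMTL k → Set
T ⊨sync φ = SatH sync T Π∅ φ 0ℚ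

{-# OPTIONS --safe #-}
-- Without clocks and with every interval equal to [0,∞), satisfaction depends only on the
-- relative order of the events of the quantified traces. An assignment of traces to the
-- variables bound so far is therefore represented by a merged word: a word of columns, one
-- per time point, recording the letter of each bound trace at that point (or its absence),
-- starting with a column at time 0. By induction on the quantifier prefix we build a DFA over
-- columns accepting exactly the merged words of the assignments that satisfy the rest of the
-- formula. For the quantifier-free body, an automaton guesses the truth values of all
-- subformulas at every column and checks them locally; Until and Since unfold one column at a
-- time, so every consistent guess is the true one. For ∃π the automaton guesses the new row,
-- interleaving padding columns where only the new trace has an event, and checks that this
-- row is accepted by 𝒜 (and, synchronously, shares the timestamps of the other traces); every
-- accepted guess is realised by rational timestamps, by density of ℚ. ∀ is handled by
-- complementation. Acceptance of the single column at time 0 then decides the formula.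
module Submission where

open import Defs hiding (trans)
open import Data.Bool using (Bool; true; false; not; T) renaming (_∧_ to _&&_; _∨_ to _||_)
import Data.Bool.Properties as Bool
open import Data.Bool.ListAction using (any)
open import Data.Empty using (⊥; ⊥-elim)
open import Data.Fin using (Fin)
import Data.Fin.Properties as Fin
open import Data.List using (List; []; _∷_; length; lookup; map; cartesianProduct; cartesianProductWith; allFin; foldl; reverse; reverseAcc)
open import Data.List.Membership.Propositional using (_∈_; _∉_; find; lose)
open import Data.List.Membership.Propositional.Properties using (∈-map⁺; ∈-map⁻; ∈-cartesianProduct⁺; ∈-cartesianProductWith⁺; ∈-allFin)
open import Data.List.Relation.Unary.All as All using (All; []; _∷_)
import Data.List.Relation.Unary.All.Properties as All
open import Data.List.Relation.Unary.Any as Any using (Any; here; there)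
open import Data.List.Relation.Unary.Any.Properties using (lookup-index; any⁺; any⁻; reverse⁺; reverse⁻)
open import Data.List.Relation.Unary.Linked using (Linked; []; [-]; _∷_)
import Data.List.Relation.Unary.Linked.Properties as Linked
open import Data.Maybe using (Maybe; just; nothing; is-just)
import Data.Maybe.Properties as Maybe
open import Data.Nat as ℕ using (ℕ; zero; suc)
open import Data.Product using (∃; ∃₂; _×_; _,_; proj₁; proj₂)
import Data.Product.Properties as Product
open import Data.Rational using (ℚ; 0ℚ; 1ℚ; _<_; _≤_; _+_; _-_; -_)
import Data.Rational.Properties as ℚ
open import Data.Sum as Sum using (_⊎_; inj₁; inj₂; [_,_]; map₂)
open import Data.Unit using (⊤; tt)
open import Data.Vec as Vec using (Vec; []; _∷_; tabulate)
import Data.Vec.Properties as Vec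
open import Function using (_⇔_; mk⇔; Equivalence; _∘_; _∘′_)
import Function.Properties.Equivalence as ⇔
open import Relation.Binary.Construct.Closure.ReflexiveTransitive using (Star; ε; _◅_)
open import Relation.Binary.Definitions using (DecidableEquality; tri<; tri≈; tri>)
open import Relation.Binary.PropositionalEquality using (_≡_; _≢_; refl; sym; trans; cong; subst)
open import Relation.Nullary using (¬_; Dec; yes; no; does; proof; _because_)
open import Relation.Nullary.Decidable as Dec using (map′; _×-dec_; _⊎-dec_; T?; toWitness)
open import Relation.Nullary.Reflects using (Reflects; ofʸ; ofⁿ; fromEquivalence; det; T-reflects; ¬-reflects; _×-reflects_; _⊎-reflects_; _→-reflects_)
open import Relation.Unary using (Decidable)

Reflects⇒T⇔ : ∀ {P : Set} {b} → Reflects P b → T b ⇔ P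
Reflects⇒T⇔ (ofʸ p)  = mk⇔ (λ _ → p) (λ _ → tt)
Reflects⇒T⇔ (ofⁿ ¬p) = mk⇔ (λ ()) ¬p

Reflects-≡ : ∀ {P : Set} {b c} → b ≡ c → Reflects P c → Reflects P b
Reflects-≡ refl r = r

Reflects-⇔ : ∀ {P Q : Set} {b} → P ⇔ Q → Reflects P b → Reflects Q b
Reflects-⇔ P⇔Q r = fromEquivalence (Equivalence.to P⇔Q ∘′ Equivalence.to (Reflects⇒T⇔ r))
                                   (Equivalence.from (Reflects⇒T⇔ r) ∘′ Equivalence.from P⇔Q)

T-does⇔ : {P : Set} (P? : Dec P) → T (does P?) ⇔ P
T-does⇔ P? = Reflects⇒T⇔ (proof P?)

¬-⇔ : {P Q : Set} → P ⇔ Q → (¬ P) ⇔ (¬ Q)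
¬-⇔ P⇔Q = mk⇔ (λ ¬p q → ¬p (Equivalence.from P⇔Q q)) (λ ¬q p → ¬q (Equivalence.to P⇔Q p))

-- Finite types and automata

record Finite (A : Set) : Set where
  field
    elements   : List A
    ∈-elements : ∀ a → a ∈ elements
    _≟_        : DecidableEquality A

  any? : {P : A → Set} → Decidable P → Dec (∃ P)
  any? P? = map′ (λ h → let (a , _ , p) = find h in a , p)
                 (λ (a , p) → lose (∈-elements a) p)
                 (Any.any? P? elements)

Bool-finite : Finite Bool
Bool-finite = record
  { elements   = true ∷ false ∷ []
  ; ∈-elements = λ { true → here refl ; false → there (here refl) }
  ; _≟_        = Bool._≟_
  }

⊤-finite : Finite ⊤
⊤-finite = record
  { elements = tt ∷ [] ; ∈-elements = λ _ → here refl ; _≟_ = λ _ _ → yes refl }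

Maybe-finite : ∀ {A} → Finite A → Finite (Maybe A)
Maybe-finite FA = record
  { elements   = nothing ∷ map just elements
  ; ∈-elements = λ { nothing → here refl ; (just a) → there (∈-map⁺ just (∈-elements a)) }
  ; _≟_        = Maybe.≡-dec _≟_
  }
  where open Finite FA

×-finite : ∀ {A B} → Finite A → Finite B → Finite (A × B)
×-finite FA FB = record
  { elements   = cartesianProduct (elements FA) (elements FB)
  ; ∈-elements = λ (a , b) → ∈-cartesianProduct⁺ (∈-elements FA a) (∈-elements FB b)
  ; _≟_        = Product.≡-dec (_≟_ FA) (_≟_ FB)
  }
  where open Finite

vectors : {A : Set} → List A → ∀ n → List (Vec A n)
vectors xs zero    = [] ∷ []
vectors xs (suc n) = cartesianProductWith _∷_ xs (vectors xs n)

Vec-finite : ∀ {A} → Finite A → ∀ n → Finite (Vec A n)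
Vec-finite FA n = record
  { elements = vectors elements n ; ∈-elements = ∈-vectors ; _≟_ = Vec.≡-dec _≟_ }
  where
  open Finite FA
  ∈-vectors : ∀ {n} (v : Vec _ n) → v ∈ vectors elements n
  ∈-vectors []       = here refl
  ∈-vectors (a ∷ v) = ∈-cartesianProductWith⁺ _∷_ (∈-elements a) (∈-vectors v)

Fin-finite : ∀ n → Finite (Fin n)
Fin-finite n = record { elements = allFin n ; ∈-elements = ∈-allFin ; _≟_ = Fin._≟_ }

module Reachability {V : Set} (E : V → V → Set) where

  -- Deciding PathVia by induction on the allowed inner vertices xs is the Floyd–Warshall recursion.

  data PathVia (xs : List V) : V → V → Set where
    edge : ∀ {u v} → E u v → PathVia xs u v
    via  : ∀ {u y v} → E u y → y ∈ xs → PathVia xs y v → PathVia xs u v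

  widen : ∀ {x xs u v} → PathVia xs u v → PathVia (x ∷ xs) u v
  widen (edge e)     = edge e
  widen (via e y∈ p) = via e (there y∈) (widen p)

  concat : ∀ {xs u y v} → PathVia xs u y → y ∈ xs → PathVia xs y v → PathVia xs u v
  concat (edge e)     y∈ q = via e y∈ q
  concat (via e z∈ p) y∈ q = via e z∈ (concat p y∈ q)

  PathVia-∷⁻ : ∀ {x xs u v} → PathVia (x ∷ xs) u v →
               PathVia xs u v ⊎ (PathVia xs u x × PathVia xs x v)
  PathVia-∷⁻ (edge e) = inj₁ (edge e)
  PathVia-∷⁻ (via e (here refl) p) with PathVia-∷⁻ p
  ... | inj₁ q       = inj₂ (edge e , q)
  ... | inj₂ (_ , q) = inj₂ (edge e , q)
  PathVia-∷⁻ (via e (there y∈) p) with PathVia-∷⁻ p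
  ... | inj₁ q        = inj₁ (via e y∈ q)
  ... | inj₂ (q , q′) = inj₂ (via e y∈ q , q′)

  PathVia-∷⁺ : ∀ {x xs u v} → PathVia xs u v ⊎ (PathVia xs u x × PathVia xs x v) →
               PathVia (x ∷ xs) u v
  PathVia-∷⁺ (inj₁ p)       = widen p
  PathVia-∷⁺ (inj₂ (p , q)) = concat (widen p) (here refl) (widen q)

  module _ (E? : ∀ u v → Dec (E u v)) where

    pathVia? : ∀ xs u v → Dec (PathVia xs u v)
    pathVia? []       u v = map′ edge (λ { (edge e) → e ; (via _ () _) }) (E? u v)
    pathVia? (x ∷ xs) u v =
      map′ PathVia-∷⁺ PathVia-∷⁻ (pathVia? xs u v ⊎-dec (pathVia? xs u x ×-dec pathVia? xs x v))

  PathVia⇒Star : ∀ {xs u v} → PathVia xs u v → Star E u v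
  PathVia⇒Star (edge e)    = e ◅ ε
  PathVia⇒Star (via e _ p) = e ◅ PathVia⇒Star p

  Star⇒PathVia : ∀ {xs} → (∀ v → v ∈ xs) → ∀ {u v} → Star E u v → u ≡ v ⊎ PathVia xs u v
  Star⇒PathVia all ε = inj₁ refl
  Star⇒PathVia all (e ◅ s) with Star⇒PathVia all s
  ... | inj₁ refl = inj₂ (edge e)
  ... | inj₂ p    = inj₂ (via e (all _) p)

  Star? : Finite V → (∀ u v → Dec (E u v)) → ∀ u v → Dec (Star E u v)
  Star? FV E? u v =
    map′ [ (λ { refl → ε }) , PathVia⇒Star ] (Star⇒PathVia ∈-elements)
         ((u ≟ v) ⊎-dec pathVia? E? elements u v)
    where open Finite FV

record DFA (A : Set) : Set₁ where
  field
    Q        : Set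
    Q-finite : Finite Q
    start    : Q
    δ        : Q → A → Q
    final    : Q → Bool

  δ* : Q → List A → Q
  δ* = foldl δ

  Accepts : List A → Set
  Accepts w = T (final (δ* start w))

  accepts? : ∀ w → Dec (Accepts w)
  accepts? w = T? _

complement : ∀ {A} → DFA A → DFA A
complement D = record D { final = λ q → not (DFA.final D q) }

Accepts-complement : ∀ {A} (D : DFA A) w → DFA.Accepts (complement D) w ⇔ (¬ DFA.Accepts D w)
Accepts-complement D w = Reflects⇒T⇔ (¬-reflects (T-reflects (DFA.final D (DFA.δ* D (DFA.start D) w))))

record NFA (A : Set) : Set₁ where
  field
    Q        : Set
    Q-finite : Finite Q
    Initial  : Q → Set
    Initial? : Decidable Initial
    Step     : Q → A → Q → Set
    Step?    : ∀ q a q′ → Dec (Step q a q′)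
    Final    : Q → Set
    Final?   : Decidable Final

module _ {A : Set} (N : NFA A) where
  open NFA N

  data Run : Q → List A → Set where
    done : ∀ {q} → Final q → Run q []
    _∷_  : ∀ {q a q′ w} → Step q a q′ → Run q′ w → Run q (a ∷ w)

  Accepts : List A → Set
  Accepts w = ∃ λ q → Initial q × Run q w

module Determinise {A : Set} (N : NFA A) where
  open NFA N
  open Finite Q-finite using (elements; ∈-elements; any?)

  size : ℕ
  size = length elements

  state : Fin size → Q
  state = lookup elements

  index : Q → Fin size
  index q = Any.index (∈-elements q)

  state-index : ∀ q → state (index q) ≡ q
  state-index q = sym (lookup-index (∈-elements q))

  Subset : Set
  Subset = Vec Bool size

  _∋_ : Subset → Q → Set
  S ∋ q = T (Vec.lookup S (index q))

  _∋?_ : ∀ S q → Dec (S ∋ q)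
  S ∋? q = T? _

  subset : {P : Q → Set} → Decidable P → Subset
  subset P? = tabulate λ i → does (P? (state i))

  subset-∋ : ∀ {P : Q → Set} (P? : Decidable P) q → subset P? ∋ q ⇔ P q
  subset-∋ {P} P? q
    rewrite Vec.lookup∘tabulate (λ i → does (P? (state i))) (index q)
    = mk⇔ (λ t → subst P (state-index q) (Equivalence.to (T-does⇔ (P? _)) t))
          (λ p → Equivalence.from (T-does⇔ (P? _)) (subst P (sym (state-index q)) p))

  move : Subset → A → Subset
  move S a = subset λ q′ → any? λ q → (S ∋? q) ×-dec Step? q a q′

  move-∋ : ∀ S a q′ → move S a ∋ q′ ⇔ (∃ λ q → S ∋ q × Step q a q′)
  move-∋ S a = subset-∋ λ q′ → any? λ q → (S ∋? q) ×-dec Step? q a q′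

  final? : ∀ S → Dec (∃ λ q → S ∋ q × Final q)
  final? S = any? λ q → (S ∋? q) ×-dec Final? q

  determinise : DFA A
  determinise = record
    { Q = Subset ; Q-finite = Vec-finite Bool-finite size
    ; start = subset Initial? ; δ = move ; final = λ S → does (final? S) }

  open DFA determinise using (δ*)

  accepting⇒Run : ∀ S w → T (does (final? (δ* S w))) → ∃ λ q → S ∋ q × Run N q w
  accepting⇒Run S []      t = let (q , q∈S , f) = Equivalence.to (T-does⇔ (final? S)) t in q , q∈S , done f
  accepting⇒Run S (a ∷ w) t with accepting⇒Run (move S a) w t
  ... | q′ , q′∈ , r =
    let (q , q∈S , s) = Equivalence.to (move-∋ S a q′) q′∈ in q , q∈S , s ∷ r

  Run⇒accepting : ∀ S w q → S ∋ q → Run N q w → T (does (final? (δ* S w)))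
  Run⇒accepting S []      q q∈S (done f) = Equivalence.from (T-does⇔ (final? S)) (q , q∈S , f)
  Run⇒accepting S (a ∷ w) q q∈S (_∷_ {q′ = q′} s r) =
    Run⇒accepting (move S a) w q′ (Equivalence.from (move-∋ S a q′) (q , q∈S , s)) r

  Accepts-determinise : ∀ w → DFA.Accepts determinise w ⇔ Accepts N w
  Accepts-determinise w = mk⇔
    (λ t → let (q , q∈ , r) = accepting⇒Run _ w t in q , Equivalence.to (subset-∋ Initial? q) q∈ , r)
    (λ (q , i , r) → Run⇒accepting _ w q (Equivalence.from (subset-∋ Initial? q) i) r)

open Determinise public using (determinise; Accepts-determinise)

module _ {A : Set} (D : DFA A) (N : NFA A) where
  private
    module D = DFA D
    module N = NFA N

  _⊗_ : NFA A
  _⊗_ = record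
    { Q = D.Q × N.Q ; Q-finite = ×-finite D.Q-finite N.Q-finite
    ; Initial = λ (q , s) → q ≡ D.start × N.Initial s
    ; Initial? = λ (q , s) → Finite._≟_ D.Q-finite q D.start ×-dec N.Initial? s
    ; Step = λ (q , s) a (q′ , s′) → D.δ q a ≡ q′ × N.Step s a s′
    ; Step? = λ (q , s) a (q′ , s′) → Finite._≟_ D.Q-finite (D.δ q a) q′ ×-dec N.Step? s a s′
    ; Final = λ (q , s) → T (D.final q) × N.Final s
    ; Final? = λ (q , s) → T? (D.final q) ×-dec N.Final? s
    }

  Run-⊗⁺ : ∀ q s w → T (D.final (D.δ* q w)) → Run N s w → Run _⊗_ (q , s) w
  Run-⊗⁺ q s []      f (done f′) = done (f , f′)
  Run-⊗⁺ q s (a ∷ w) f (st ∷ r)  = (refl , st) ∷ Run-⊗⁺ (D.δ q a) _ w f r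

  Run-⊗⁻ : ∀ q s w → Run _⊗_ (q , s) w → T (D.final (D.δ* q w)) × Run N s w
  Run-⊗⁻ q s []      (done (f , f′))   = f , done f′
  Run-⊗⁻ q s (a ∷ w) ((refl , st) ∷ r) = let (f , r′) = Run-⊗⁻ (D.δ q a) _ w r in f , st ∷ r′

  Accepts-⊗ : ∀ w → Accepts _⊗_ w ⇔ (DFA.Accepts D w × Accepts N w)
  Accepts-⊗ w = mk⇔ to from
    where
    to : Accepts _⊗_ w → DFA.Accepts D w × Accepts N w
    to ((q , s) , (refl , i) , r) = let (f , r′) = Run-⊗⁻ q s w r in f , s , i , r′
    from : DFA.Accepts D w × Accepts N w → Accepts _⊗_ w
    from (f , s , i , r) = (D.start , s) , (refl , i) , Run-⊗⁺ D.start s w f r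

module Projection {A B X : Set} (extend : X → A → B) (padding : X → B) where

  data Extends : List B → List A → Set where
    []  : Extends [] []
    pad : ∀ x {w′ w} → Extends w′ w → Extends (padding x ∷ w′) w
    ext : ∀ x {a w′ w} → Extends w′ w → Extends (extend x a ∷ w′) (a ∷ w)

  data Extends₀ : List B → List A → Set where
    ext : ∀ x {a w′ w} → Extends w′ w → Extends₀ (extend x a ∷ w′) (a ∷ w)

  module _ (X-finite : Finite X) (M : NFA B) where
    open NFA M
    open Finite using (any?)

    Pad : Q → Q → Set
    Pad q q′ = ∃ λ x → Step q (padding x) q′

    Pad? : ∀ q q′ → Dec (Pad q q′)
    Pad? q q′ = any? X-finite λ x → Step? q (padding x) q′

    Padded : Q → Q → Set
    Padded = Star Pad

    Padded? : ∀ q q′ → Dec (Padded q q′)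
    Padded? = Reachability.Star? Pad Q-finite Pad?

    Extend : Q → A → Q → Set
    Extend q a q′ = ∃ λ x → Step q (extend x a) q′

    Extend? : ∀ q a q′ → Dec (Extend q a q′)
    Extend? q a q′ = any? X-finite λ x → Step? q (extend x a) q′

    State : Set
    State = Bool × Q

    Step′ : State → A → State → Set
    Step′ (false , q) a (true , q′) = Extend q a q′
    Step′ (true , q)  a (true , q′) = ∃ λ q₁ → Padded q q₁ × Extend q₁ a q′
    Step′ _           a (false , _) = ⊥

    Step′? : ∀ p a p′ → Dec (Step′ p a p′)
    Step′? (false , q) a (true , q′)  = Extend? q a q′
    Step′? (true , q)  a (true , q′)  = any? Q-finite λ q₁ → Padded? q q₁ ×-dec Extend? q₁ a q′
    Step′? (false , q) a (false , q′) = no λ ()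
    Step′? (true , q)  a (false , q′) = no λ ()

    Final′ : State → Set
    Final′ (false , _) = ⊥
    Final′ (true , q)  = ∃ λ q₁ → Padded q q₁ × Final q₁

    Final′? : ∀ p → Dec (Final′ p)
    Final′? (false , _) = no λ ()
    Final′? (true , q)  = any? Q-finite λ q₁ → Padded? q q₁ ×-dec Final? q₁

    projection : NFA A
    projection = record
      { Q = State ; Q-finite = ×-finite Bool-finite Q-finite
      ; Initial = λ (b , q) → b ≡ false × Initial q
      ; Initial? = λ (b , q) → (b Bool.≟ false) ×-dec Initial? q
      ; Step = Step′ ; Step? = Step′? ; Final = Final′ ; Final? = Final′? }

    padded-run : ∀ {q q₁ w} → Padded q q₁ →
                 (∃ λ w′ → Extends w′ w × Run M q₁ w′) → ∃ λ w′ → Extends w′ w × Run M q w′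
    padded-run ε                 r = r
    padded-run ((x , st) ◅ path) r with padded-run path r
    ... | w′ , e , rm = padding x ∷ w′ , pad x e , st ∷ rm

    Run⇒Extends : ∀ {q w} → Run projection (true , q) w → ∃ λ w′ → Extends w′ w × Run M q w′
    Run⇒Extends (done (_ , path , f)) = padded-run path ([] , [] , done f)
    Run⇒Extends (_∷_ {q′ = false , _} () _)
    Run⇒Extends (_∷_ {q′ = true , _} (_ , path , x , st) r) with Run⇒Extends r
    ... | w′ , e , rm = padded-run path (extend x _ ∷ w′ , ext x e , st ∷ rm)

    pad-run : ∀ {q q′ w} → Pad q q′ → Run projection (true , q′) w → Run projection (true , q) w
    pad-run p (done (q₁ , path , f))                   = done (q₁ , p ◅ path , f)
    pad-run p (_∷_ {q′ = false , _} () _)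
    pad-run p (_∷_ {q′ = true , _} (q₁ , path , ex) r) = (q₁ , p ◅ path , ex) ∷ r

    Extends⇒Run : ∀ {q w w′} → Extends w′ w → Run M q w′ → Run projection (true , q) w
    Extends⇒Run []        (done f) = done (_ , ε , f)
    Extends⇒Run (pad x e) (st ∷ r) = pad-run (x , st) (Extends⇒Run e r)
    Extends⇒Run (ext x e) (st ∷ r) = (_ , ε , x , st) ∷ Extends⇒Run e r

    Accepts-projection : ∀ w → Accepts projection w ⇔ (∃ λ w′ → Extends₀ w′ w × Accepts M w′)
    Accepts-projection w = mk⇔ to from
      where
      to : Accepts projection w → ∃ λ w′ → Extends₀ w′ w × Accepts M w′
      to ((false , q) , (refl , i) , _∷_ {q′ = false , _} () _)
      to ((false , q) , (refl , i) , _∷_ {q′ = true , _} (x , st) r) with Run⇒Extends r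
      ... | w′ , e , rm = extend x _ ∷ w′ , ext x e , q , i , st ∷ rm
      from : (∃ λ w′ → Extends₀ w′ w × Accepts M w′) → Accepts projection w
      from (_ , ext x e , q , i , st ∷ r) = (false , q) , (refl , i) , (x , st) ∷ Extends⇒Run e r

-- Untimed Until, unfolded one time point at a time

unfold⁺ : Bool → Bool → Bool → Bool → Bool
unfold⁺ l a b u = (l && b) || ((not l || a) && u)

unfold⁻ : Bool → Bool → Bool → Bool → Bool
unfold⁻ l a b u = (not l || b) && ((l && a) || u)

module Until {Tm : Set} (_≺_ : Tm → Tm → Set)
  (≺-trans : ∀ {a b c} → a ≺ b → b ≺ c → a ≺ c) (≺-irrefl : ∀ {a} → ¬ a ≺ a)
  (Live A⁺ A⁻ B⁺ B⁻ : Tm → Set) where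

  U⁺ : Tm → Set
  U⁺ t = ∃ λ t′ → t ≺ t′ × Live t′ × B⁺ t′ × (∀ s → t ≺ s → s ≺ t′ → Live s → A⁺ s)

  U⁻ : Tm → Set
  U⁻ t = ∀ t′ → t ≺ t′ → Live t′ → B⁻ t′ ⊎ ∃ λ s → t ≺ s × s ≺ t′ × Live s × A⁻ s

  Next : Tm → Tm → Set
  Next t t′ = t ≺ t′ × (∀ s → t ≺ s → Live s → s ≡ t′ ⊎ t′ ≺ s)

  Last : Tm → Set
  Last t = ∀ s → t ≺ s → ¬ Live s

  U⁺-last : ∀ {t} → Last t → Reflects (U⁺ t) false
  U⁺-last last = ofⁿ λ (s , t≺s , live , _) → last s t≺s live

  U⁻-last : ∀ {t} → Last t → Reflects (U⁻ t) true
  U⁻-last last = ofʸ λ s t≺s live → ⊥-elim (last s t≺s live)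

  module _ {t t′ : Tm} (t-next : Next t t′) where
    private
      t≺t′ : t ≺ t′
      t≺t′ = proj₁ t-next
      next : ∀ s → t ≺ s → Live s → s ≡ t′ ⊎ t′ ≺ s
      next = proj₂ t-next

    nothing-between : ∀ s → t ≺ s → s ≺ t′ → ¬ Live s
    nothing-between s t≺s s≺t′ live with next s t≺s live
    ... | inj₁ refl = ≺-irrefl s≺t′
    ... | inj₂ t′≺s = ≺-irrefl (≺-trans s≺t′ t′≺s)

    U⁺-unfold : U⁺ t ⇔ ((Live t′ × B⁺ t′) ⊎ ((Live t′ → A⁺ t′) × U⁺ t′))
    U⁺-unfold = mk⇔ to from
      where
      to : U⁺ t → (Live t′ × B⁺ t′) ⊎ ((Live t′ → A⁺ t′) × U⁺ t′)
      to (s , t≺s , live , b , a) with next s t≺s live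
      ... | inj₁ refl = inj₁ (live , b)
      ... | inj₂ t′≺s = inj₂ (a t′ t≺t′ t′≺s , s , t′≺s , live , b , λ r t′≺r → a r (≺-trans t≺t′ t′≺r))
      from : (Live t′ × B⁺ t′) ⊎ ((Live t′ → A⁺ t′) × U⁺ t′) → U⁺ t
      from (inj₁ (live , b)) = t′ , t≺t′ , live , b , λ s t≺s s≺t′ live → ⊥-elim (nothing-between s t≺s s≺t′ live)
      from (inj₂ (a′ , s , t′≺s , live , b , a)) = s , ≺-trans t≺t′ t′≺s , live , b , a″
        where
        a″ : ∀ r → t ≺ r → r ≺ s → Live r → A⁺ r
        a″ r t≺r r≺s live-r with next r t≺r live-r
        ... | inj₁ refl = a′ live-r
        ... | inj₂ t′≺r = a r t′≺r r≺s live-r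

    U⁻-unfold : Dec (Live t′ × A⁻ t′) → U⁻ t ⇔ ((Live t′ → B⁻ t′) × ((Live t′ × A⁻ t′) ⊎ U⁻ t′))
    U⁻-unfold here? = mk⇔ to from
      where
      at-t′ : U⁻ t → Live t′ → B⁻ t′
      at-t′ u live with u t′ t≺t′ live
      ... | inj₁ b = b
      ... | inj₂ (s , t≺s , s≺t′ , live-s , _) = ⊥-elim (nothing-between s t≺s s≺t′ live-s)
      after-t′ : U⁻ t → ¬ (Live t′ × A⁻ t′) → U⁻ t′
      after-t′ u ¬here s t′≺s live with u s (≺-trans t≺t′ t′≺s) live
      ... | inj₁ b = inj₁ b
      ... | inj₂ (r , t≺r , r≺s , live-r , a) with next r t≺r live-r
      ...   | inj₁ refl = ⊥-elim (¬here (live-r , a))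
      ...   | inj₂ t′≺r = inj₂ (r , t′≺r , r≺s , live-r , a)
      here-or-after : Dec (Live t′ × A⁻ t′) → U⁻ t → (Live t′ × A⁻ t′) ⊎ U⁻ t′
      here-or-after (yes h)  u = inj₁ h
      here-or-after (no ¬h) u = inj₂ (after-t′ u ¬h)
      to : U⁻ t → (Live t′ → B⁻ t′) × ((Live t′ × A⁻ t′) ⊎ U⁻ t′)
      to u = at-t′ u , here-or-after here? u
      from : (Live t′ → B⁻ t′) × ((Live t′ × A⁻ t′) ⊎ U⁻ t′) → U⁻ t
      from (b , rest) s t≺s live with next s t≺s live
      from (b , rest)         s t≺s live | inj₁ refl = inj₁ (b live)
      from (b , inj₁ (l , a)) s t≺s live | inj₂ t′≺s = inj₂ (t′ , t≺t′ , t′≺s , l , a)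
      from (b , inj₂ u)       s t≺s live | inj₂ t′≺s with u s t′≺s live
      ... | inj₁ b′ = inj₁ b′
      ... | inj₂ (r , t′≺r , r≺s , live-r , a) = inj₂ (r , ≺-trans t≺t′ t′≺r , r≺s , live-r , a)

    module _ {l a⁺ a⁻ b⁺ b⁻ : Bool} (l-r : Reflects (Live t′) l)
             (a⁺-r : Reflects (A⁺ t′) a⁺) (a⁻-r : Reflects (A⁻ t′) a⁻)
             (b⁺-r : Reflects (B⁺ t′) b⁺) (b⁻-r : Reflects (B⁻ t′) b⁻) where

      U⁺-reflects : ∀ {u} → Reflects (U⁺ t′) u → Reflects (U⁺ t) (unfold⁺ l a⁺ b⁺ u)
      U⁺-reflects u-r = Reflects-⇔ (⇔.sym U⁺-unfold)
                                   ((l-r ×-reflects b⁺-r) ⊎-reflects ((l-r →-reflects a⁺-r) ×-reflects u-r))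

      U⁻-reflects : ∀ {u} → Reflects (U⁻ t′) u → Reflects (U⁻ t) (unfold⁻ l a⁻ b⁻ u)
      U⁻-reflects u-r = Reflects-⇔ (⇔.sym (U⁻-unfold (_ because here-r)))
                                   ((l-r →-reflects b⁻-r) ×-reflects (here-r ⊎-reflects u-r))
        where
        here-r : Reflects (Live t′ × A⁻ t′) (l && a⁻)
        here-r = l-r ×-reflects a⁻-r

  module Chains {E : Set} (time : E → Tm) (live a⁺ a⁻ b⁺ b⁻ u⁺ u⁻ : E → Bool) where

    Inputs : E → Set
    Inputs x = Reflects (Live (time x)) (live x)
             × Reflects (A⁺ (time x)) (a⁺ x) × Reflects (A⁻ (time x)) (a⁻ x)
             × Reflects (B⁺ (time x)) (b⁺ x) × Reflects (B⁻ (time x)) (b⁻ x)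

    Outputs : E → Set
    Outputs x = Reflects (U⁺ (time x)) (u⁺ x) × Reflects (U⁻ (time x)) (u⁻ x)

    data Chain : E → List E → Set where
      end  : ∀ {e} → u⁺ e ≡ false → u⁻ e ≡ true → Chain e []
      next : ∀ {e e′ es} → time e ≺ time e′ →
             u⁺ e ≡ unfold⁺ (live e′) (a⁺ e′) (b⁺ e′) (u⁺ e′) →
             u⁻ e ≡ unfold⁻ (live e′) (a⁻ e′) (b⁻ e′) (u⁻ e′) →
             Chain e′ es → Chain e (e′ ∷ es)

    Covers : E → List E → Set
    Covers e es = ∀ s → time e ≺ s → Live s → Any (λ x → time x ≡ s) es

    chain-≺ : ∀ {e es s} → Chain e es → Any (λ x → time x ≡ s) es → time e ≺ s
    chain-≺ (next e≺e′ _ _ _)  (here refl) = e≺e′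
    chain-≺ (next e≺e′ _ _ ch) (there x∈)  = ≺-trans e≺e′ (chain-≺ ch x∈)

    chain-outputs-after : ∀ {e es} → Chain e es → (∀ x → x ∈ es → Inputs x) → Covers e es →
                          ∀ x → x ∈ e ∷ es → Outputs x
    chain-outputs-after (end u⁺≡ u⁻≡) _ covers _ (here refl) =
      Reflects-≡ u⁺≡ (U⁺-last last) , Reflects-≡ u⁻≡ (U⁻-last last)
      where
      last : Last _
      last s e≺s live with covers s e≺s live
      ... | ()
    chain-outputs-after {e} (next {e′ = e′} {es} e≺e′ u⁺≡ u⁻≡ ch) inputs covers = outputs
      where
      covers′ : Covers e′ es
      covers′ s e′≺s live with covers s (≺-trans e≺e′ e′≺s) live
      ... | here refl = ⊥-elim (≺-irrefl e′≺s)
      ... | there x∈  = x∈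
      next′ : Next (time e) (time e′)
      next′ = e≺e′ , λ s e≺s live → Sum.map sym (chain-≺ ch) (Any.toSum (covers s e≺s live))
      ih : ∀ x → x ∈ e′ ∷ es → Outputs x
      ih = chain-outputs-after ch (λ x x∈ → inputs x (there x∈)) covers′
      outputs : ∀ x → x ∈ e ∷ e′ ∷ es → Outputs x
      outputs x (there x∈) = ih x x∈
      outputs x (here refl) with inputs e′ (here refl) | ih e′ (here refl)
      ... | l , a⁺-r , a⁻-r , b⁺-r , b⁻-r | u⁺-r , u⁻-r =
        Reflects-≡ u⁺≡ (U⁺-reflects next′ l a⁺-r a⁻-r b⁺-r b⁻-r u⁺-r) ,
        Reflects-≡ u⁻≡ (U⁻-reflects next′ l a⁺-r a⁻-r b⁺-r b⁻-r u⁻-r)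

    chain-outputs : ∀ {e es} → Chain e es → (∀ x → x ∈ es → Inputs x) →
                    (∀ s → Live s → Any (λ x → time x ≡ s) (e ∷ es)) →
                    ∀ x → x ∈ e ∷ es → Outputs x
    chain-outputs ch inputs covers = chain-outputs-after ch inputs after
      where
      after : Covers _ _
      after s e≺s live with covers s live
      ... | here refl = ⊥-elim (≺-irrefl e≺s)
      ... | there x∈  = x∈

-- Merged words

module MergedWords (k : ℕ) where

  Column : ℕ → Set
  Column n = Vec (Maybe (Letter k)) n

  cell : (bs : List Var) → Var → Column (length bs) → Maybe (Letter k)
  cell []       π []      = nothing
  cell (b ∷ bs) π (x ∷ c) with π ℕ.≟ b
  ... | yes _ = x
  ... | no  _ = cell bs π c

  isBound : List Var → Var → Bool
  isBound []       π = false
  isBound (b ∷ bs) π with π ℕ.≟ b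
  ... | yes _ = true
  ... | no  _ = isBound bs π

  isBound-here : ∀ b bs → isBound (b ∷ bs) b ≡ true
  isBound-here b bs with b ℕ.≟ b
  ... | yes _   = refl
  ... | no b≢b = ⊥-elim (b≢b refl)

  isLive : (bs : List Var) → Column (length bs) → Bool
  isLive bs c = any (λ π → is-just (cell bs π c)) bs

  holds : Bool → Maybe (Letter k) → Fin k → Bool
  holds b nothing  p = false
  holds b (just σ) p = does (Vec.lookup σ p Bool.≟ b)

  cell-just⇒∈ : ∀ bs π c → T (is-just (cell bs π c)) → π ∈ bs
  cell-just⇒∈ []       π []      ()
  cell-just⇒∈ (b ∷ bs) π (x ∷ c) j with π ℕ.≟ b
  ... | yes refl = here refl
  ... | no  _    = there (cell-just⇒∈ bs π c j)

  cell-just⇒isBound : ∀ bs π c → T (is-just (cell bs π c)) → isBound bs π ≡ true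
  cell-just⇒isBound []       π []      ()
  cell-just⇒isBound (b ∷ bs) π (x ∷ c) j with π ℕ.≟ b
  ... | yes _ = refl
  ... | no  _ = cell-just⇒isBound bs π c j

  isLive⁺ : ∀ bs π c → T (is-just (cell bs π c)) → T (isLive bs c)
  isLive⁺ bs π c j = any⁺ _ (lose (cell-just⇒∈ bs π c j) j)

  isLive⁻ : ∀ bs c → T (isLive bs c) → ∃ λ π → T (is-just (cell bs π c))
  isLive⁻ bs c l = Any.satisfied (any⁻ _ bs l)

  Stamped : Set → Set
  Stamped X = List (X × ℚ)

  prepend : Maybe (Letter k) → ℚ → Stamped (Letter k) → Stamped (Letter k)
  prepend nothing  t es = es
  prepend (just σ) t es = (σ , t) ∷ es

  rowOf : ∀ {X : Set} → (X → Maybe (Letter k)) → Stamped X → Stamped (Letter k)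
  rowOf f []            = []
  rowOf f ((c , t) ∷ W) = prepend (f c) t (rowOf f W)

  module _ {X : Set} (f : X → Maybe (Letter k)) where

    ∈-rowOf⁻ : ∀ W {σ t} → (σ , t) ∈ rowOf f W → ∃ λ c → (c , t) ∈ W × f c ≡ just σ
    ∈-rowOf⁻ ((c , _) ∷ W) σ∈ with f c in eq
    ∈-rowOf⁻ ((c , _) ∷ W) σ∈         | nothing = let (c′ , c∈ , e) = ∈-rowOf⁻ W σ∈ in c′ , there c∈ , e
    ∈-rowOf⁻ ((c , _) ∷ W) (here refl) | just σ  = c , here refl , eq
    ∈-rowOf⁻ ((c , _) ∷ W) (there σ∈) | just σ  = let (c′ , c∈ , e) = ∈-rowOf⁻ W σ∈ in c′ , there c∈ , e

    ∈-rowOf⁺ : ∀ W {σ t c} → (c , t) ∈ W → f c ≡ just σ → (σ , t) ∈ rowOf f W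
    ∈-rowOf⁺ ((c , t) ∷ W) (here refl) e rewrite e = here refl
    ∈-rowOf⁺ ((c , t) ∷ W) (there c∈) e with f c
    ... | nothing = ∈-rowOf⁺ W c∈ e
    ... | just _  = there (∈-rowOf⁺ W c∈ e)

    stamp-rowOf⁻ : ∀ W {t} → Any (λ e → proj₂ e ≡ t) (rowOf f W) → ∃ λ c → (c , t) ∈ W × T (is-just (f c))
    stamp-rowOf⁻ W t∈ with find t∈
    ... | _ , σ∈ , refl with ∈-rowOf⁻ W σ∈
    ...   | c , c∈ , e = c , c∈ , subst (T ∘ is-just) (sym e) tt

    stamp-rowOf⁺ : ∀ W {t c} → (c , t) ∈ W → T (is-just (f c)) → Any (λ e → proj₂ e ≡ t) (rowOf f W)
    stamp-rowOf⁺ W {c = c} c∈ j with f c in eq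
    ... | just σ = lose (∈-rowOf⁺ W c∈ eq) refl

  row : (bs : List Var) → Var → Stamped (Column (length bs)) → Stamped (Letter k)
  row bs π = rowOf (cell bs π)

  Agrees : Maybe (TW k) → Bool → Stamped (Letter k) → Set
  Agrees nothing  false _  = ⊤
  Agrees (just ρ) true  es = events ρ ≡ es
  Agrees _        _     _  = ⊥

  record Represents (bs : List Var) (W : Stamped (Column (length bs))) (Π : Assignment k) : Set where
    constructor mkRepresents
    field agrees : ∀ π → Agrees (Π π) (isBound bs π) (row bs π W)
  open Represents public

  represents-just : ∀ {bs W Π π ρ} → Represents bs W Π → Π π ≡ just ρ → events ρ ≡ row bs π W
  represents-just {bs} {W} {Π} {π} rep e with agrees rep π
  ... | agree rewrite e with isBound bs π
  ...   | true = agree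

  represents-bound : ∀ {bs W Π π} → Represents bs W Π → isBound bs π ≡ true → ∃ λ ρ → Π π ≡ just ρ
  represents-bound {bs} {W} {Π} {π} rep b with agrees rep π
  ... | agree rewrite b with Π π
  ...   | just ρ = ρ , refl

  Sorted : ∀ {X} → Stamped X → Set
  Sorted = Linked (λ x y → proj₂ x < proj₂ y)

  sorted-< : ∀ {X} {x : X × ℚ} {W} → Sorted (x ∷ W) → ∀ {y} → y ∈ W → proj₂ x < proj₂ y
  sorted-< (x<y ∷ _) (here refl) = x<y
  sorted-< (x<y ∷ s) (there y∈)  = ℚ.<-trans x<y (sorted-< s y∈)

  sorted-unique : ∀ {X} {W : Stamped X} → Sorted W → ∀ {c c′ t} → (c , t) ∈ W → (c′ , t) ∈ W → c ≡ c′
  sorted-unique s         (here refl) (here refl) = refl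
  sorted-unique s         (here refl) (there c∈)  = ⊥-elim (ℚ.<-irrefl refl (sorted-< s c∈))
  sorted-unique s         (there c∈)  (here refl) = ⊥-elim (ℚ.<-irrefl refl (sorted-< s c∈))
  sorted-unique (_ ∷ s)   (there c∈)  (there c′∈) = sorted-unique s c∈ c′∈

  module Reflection {bs : List Var} {W : Stamped (Column (length bs))} {Π : Assignment k}
                    (rep : Represents bs W Π) (sorted : Sorted W) where

    stamp⇒cell : ∀ {π ρ t} → Π π ≡ just ρ → t ∈T ρ → ∃ λ c → (c , t) ∈ W × T (is-just (cell bs π c))
    stamp⇒cell {π} e t∈ = stamp-rowOf⁻ (cell bs π) W (subst (Any _) (represents-just rep e) t∈)

    cell⇒stamp : ∀ {π c t} → (c , t) ∈ W → T (is-just (cell bs π c)) → LiveAt Π π t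
    cell⇒stamp {π} {c} c∈ j with represents-bound rep (cell-just⇒isBound bs π c j)
    ... | ρ , e = ρ , e , subst (Any _) (sym (represents-just rep e)) (stamp-rowOf⁺ (cell bs π) W c∈ j)

    Live⇒column : ∀ {t} → Live Π t → ∃ λ c → (c , t) ∈ W × T (isLive bs c)
    Live⇒column (ρ , (π , e) , t∈) with stamp⇒cell e t∈
    ... | c , c∈ , j = c , c∈ , isLive⁺ bs π c j

    Live-reflects : ∀ {c t} → (c , t) ∈ W → Reflects (Live Π t) (isLive bs c)
    Live-reflects {c} {t} c∈ = fromEquivalence to from
      where
      to : T (isLive bs c) → Live Π t
      to l with isLive⁻ bs c l
      ... | π , j with cell⇒stamp c∈ j
      ...   | ρ , e , t∈ = ρ , (π , e) , t∈
      from : Live Π t → T (isLive bs c)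
      from live with Live⇒column live
      ... | c′ , c′∈ , l = subst (T ∘ isLive bs) (sorted-unique sorted c′∈ c∈) l

    LiveAt-reflects : ∀ π {c t} → (c , t) ∈ W → Reflects (LiveAt Π π t) (is-just (cell bs π c))
    LiveAt-reflects π {c} {t} c∈ = fromEquivalence (cell⇒stamp c∈) from
      where
      from : LiveAt Π π t → T (is-just (cell bs π c))
      from (ρ , e , t∈) with stamp⇒cell e t∈
      ... | c′ , c′∈ , j = subst (λ c → T (is-just (cell bs π c))) (sorted-unique sorted c′∈ c∈) j

    PropAt-reflects : ∀ b p π {c t} → (c , t) ∈ W → Reflects (PropAt Π p π b t) (holds b (cell bs π c) p)
    PropAt-reflects b p π {c} {t} c∈ = fromEquivalence to from
      where
      to : T (holds b (cell bs π c) p) → PropAt Π p π b t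
      to h with cell bs π c in eq
      ... | just σ with represents-bound rep (cell-just⇒isBound bs π c (subst (T ∘ is-just) (sym eq) tt))
      ...   | ρ , e = ρ , e , σ , subst ((σ , t) ∈_) (sym (represents-just rep e)) (∈-rowOf⁺ (cell bs π) W c∈ eq)
                    , Equivalence.to (T-does⇔ (Vec.lookup σ p Bool.≟ b)) h
      from : PropAt Π p π b t → T (holds b (cell bs π c) p)
      from (ρ , e , σ , σ∈ , σp) with ∈-rowOf⁻ (cell bs π) W (subst ((σ , t) ∈_) (represents-just rep e) σ∈)
      ... | c′ , c′∈ , eq rewrite sorted-unique sorted c′∈ c∈ | eq = Equivalence.from (T-does⇔ (Vec.lookup σ p Bool.≟ b)) σp

-- Markings of quantifier-free formulas

module Markings (k : ℕ) (bs : List Var) where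
  open MergedWords k

  Col : Set
  Col = Column (length bs)

  -- A mark of ψ records the truth values of Sat⁺ and Sat⁻ for ψ and all its subformulas;
  -- the two are not complementary at time points where the traces involved have no event.
  mutual
    Mark : QF k → Set
    Mark ψ = Bool × Bool × SubMarks ψ

    SubMarks : QF k → Set
    SubMarks true         = ⊤
    SubMarks true[ π ]    = ⊤
    SubMarks (prop p π)   = ⊤
    SubMarks (a ∧ b)      = Mark a × Mark b
    SubMarks (¬' a)       = Mark a
    SubMarks (a U[ I ] b) = Mark a × Mark b
    SubMarks (a S[ I ] b) = Mark a × Mark b

  pos neg : ∀ {S : Set} → Bool × Bool × S → Bool
  pos (p , _ , _) = p
  neg (_ , n , _) = n

  left : ∀ {S S′ : Set} → Bool × Bool × S × S′ → S
  left (_ , _ , m , _) = m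

  right : ∀ {S S′ : Set} → Bool × Bool × S × S′ → S′
  right (_ , _ , _ , m) = m

  mutual
    Mark-finite : ∀ ψ → Finite (Mark ψ)
    Mark-finite ψ = ×-finite Bool-finite (×-finite Bool-finite (SubMarks-finite ψ))

    SubMarks-finite : ∀ ψ → Finite (SubMarks ψ)
    SubMarks-finite true         = ⊤-finite
    SubMarks-finite true[ π ]    = ⊤-finite
    SubMarks-finite (prop p π)   = ⊤-finite
    SubMarks-finite (a ∧ b)      = ×-finite (Mark-finite a) (Mark-finite b)
    SubMarks-finite (¬' a)       = Mark-finite a
    SubMarks-finite (a U[ I ] b) = ×-finite (Mark-finite a) (Mark-finite b)
    SubMarks-finite (a S[ I ] b) = ×-finite (Mark-finite a) (Mark-finite b)

  Local : Col → ∀ ψ → Mark ψ → Set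
  Local c true         (p , n , _) = p ≡ isLive bs c × n ≡ not (isLive bs c)
  Local c true[ π ]    (p , n , _) = p ≡ is-just (cell bs π c) × n ≡ not (is-just (cell bs π c))
  Local c (prop q π)   (p , n , _) = p ≡ holds true (cell bs π c) q × n ≡ holds false (cell bs π c) q
  Local c (a ∧ b)      (p , n , ma , mb) =
    p ≡ (pos ma && pos mb) × n ≡ (neg ma || neg mb) × Local c a ma × Local c b mb
  Local c (¬' a)       (p , n , ma) = p ≡ neg ma × n ≡ pos ma × Local c a ma
  Local c (a U[ I ] b) (_ , _ , ma , mb) = Local c a ma × Local c b mb
  Local c (a S[ I ] b) (_ , _ , ma , mb) = Local c a ma × Local c b mb

  Step : ∀ ψ → Bool → Mark ψ → Bool → Mark ψ → Set
  Step true         _ _ _ _ = ⊤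
  Step true[ π ]    _ _ _ _ = ⊤
  Step (prop p π)   _ _ _ _ = ⊤
  Step (a ∧ b)      l (_ , _ , ma , mb) l′ (_ , _ , ma′ , mb′) = Step a l ma l′ ma′ × Step b l mb l′ mb′
  Step (¬' a)       l (_ , _ , ma) l′ (_ , _ , ma′) = Step a l ma l′ ma′
  Step (a U[ I ] b) l (p , n , ma , mb) l′ (p′ , n′ , ma′ , mb′) =
    p ≡ unfold⁺ l′ (pos ma′) (pos mb′) p′ × n ≡ unfold⁻ l′ (neg ma′) (neg mb′) n′ ×
    Step a l ma l′ ma′ × Step b l mb l′ mb′
  Step (a S[ I ] b) l (p , n , ma , mb) l′ (p′ , n′ , ma′ , mb′) =
    p′ ≡ unfold⁺ l (pos ma) (pos mb) p × n′ ≡ unfold⁻ l (neg ma) (neg mb) n ×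
    Step a l ma l′ ma′ × Step b l mb l′ mb′

  First : ∀ ψ → Mark ψ → Set
  First true         _ = ⊤
  First true[ π ]    _ = ⊤
  First (prop p π)   _ = ⊤
  First (a ∧ b)      (_ , _ , ma , mb) = First a ma × First b mb
  First (¬' a)       (_ , _ , ma) = First a ma
  First (a U[ I ] b) (_ , _ , ma , mb) = First a ma × First b mb
  First (a S[ I ] b) (p , n , ma , mb) = p ≡ false × n ≡ true × First a ma × First b mb

  Last : ∀ ψ → Mark ψ → Set
  Last true         _ = ⊤
  Last true[ π ]    _ = ⊤
  Last (prop p π)   _ = ⊤
  Last (a ∧ b)      (_ , _ , ma , mb) = Last a ma × Last b mb
  Last (¬' a)       (_ , _ , ma) = Last a ma
  Last (a U[ I ] b) (p , n , ma , mb) = p ≡ false × n ≡ true × Last a ma × Last b mb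
  Last (a S[ I ] b) (_ , _ , ma , mb) = Last a ma × Last b mb

  private
    _≟_ : DecidableEquality Bool
    _≟_ = Bool._≟_

  Local? : ∀ c ψ m → Dec (Local c ψ m)
  Local? c true         (p , n , _) = (p ≟ _) ×-dec (n ≟ _)
  Local? c true[ π ]    (p , n , _) = (p ≟ _) ×-dec (n ≟ _)
  Local? c (prop q π)   (p , n , _) = (p ≟ _) ×-dec (n ≟ _)
  Local? c (a ∧ b)      (p , n , ma , mb) = (p ≟ _) ×-dec (n ≟ _) ×-dec Local? c a ma ×-dec Local? c b mb
  Local? c (¬' a)       (p , n , ma) = (p ≟ _) ×-dec (n ≟ _) ×-dec Local? c a ma
  Local? c (a U[ I ] b) (_ , _ , ma , mb) = Local? c a ma ×-dec Local? c b mb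
  Local? c (a S[ I ] b) (_ , _ , ma , mb) = Local? c a ma ×-dec Local? c b mb

  Step? : ∀ ψ l m l′ m′ → Dec (Step ψ l m l′ m′)
  Step? true         _ _ _ _ = yes tt
  Step? true[ π ]    _ _ _ _ = yes tt
  Step? (prop p π)   _ _ _ _ = yes tt
  Step? (a ∧ b)      l (_ , _ , ma , mb) l′ (_ , _ , ma′ , mb′) = Step? a l ma l′ ma′ ×-dec Step? b l mb l′ mb′
  Step? (¬' a)       l (_ , _ , ma) l′ (_ , _ , ma′) = Step? a l ma l′ ma′
  Step? (a U[ I ] b) l (p , n , ma , mb) l′ (_ , _ , ma′ , mb′) =
    (p ≟ _) ×-dec (n ≟ _) ×-dec Step? a l ma l′ ma′ ×-dec Step? b l mb l′ mb′
  Step? (a S[ I ] b) l (_ , _ , ma , mb) l′ (p′ , n′ , ma′ , mb′) =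
    (p′ ≟ _) ×-dec (n′ ≟ _) ×-dec Step? a l ma l′ ma′ ×-dec Step? b l mb l′ mb′

  First? : ∀ ψ m → Dec (First ψ m)
  First? true         _ = yes tt
  First? true[ π ]    _ = yes tt
  First? (prop p π)   _ = yes tt
  First? (a ∧ b)      (_ , _ , ma , mb) = First? a ma ×-dec First? b mb
  First? (¬' a)       (_ , _ , ma) = First? a ma
  First? (a U[ I ] b) (_ , _ , ma , mb) = First? a ma ×-dec First? b mb
  First? (a S[ I ] b) (p , n , ma , mb) = (p ≟ _) ×-dec (n ≟ _) ×-dec First? a ma ×-dec First? b mb

  Last? : ∀ ψ m → Dec (Last ψ m)
  Last? true         _ = yes tt
  Last? true[ π ]    _ = yes tt
  Last? (prop p π)   _ = yes tt
  Last? (a ∧ b)      (_ , _ , ma , mb) = Last? a ma ×-dec Last? b mb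
  Last? (¬' a)       (_ , _ , ma) = Last? a ma
  Last? (a U[ I ] b) (p , n , ma , mb) = (p ≟ _) ×-dec (n ≟ _) ×-dec Last? a ma ×-dec Last? b mb
  Last? (a S[ I ] b) (_ , _ , ma , mb) = Last? a ma ×-dec Last? b mb

  -- pre lists the columns before c in reverse order, suf those after it.
  mutual
    canonical : ∀ ψ → List Col → Col → List Col → Mark ψ
    canonical true       pre c suf = isLive bs c , not (isLive bs c) , tt
    canonical true[ π ]  pre c suf = is-just (cell bs π c) , not (is-just (cell bs π c)) , tt
    canonical (prop q π) pre c suf = holds true (cell bs π c) q , holds false (cell bs π c) q , tt
    canonical (a ∧ b)    pre c suf =
      let ma = canonical a pre c suf ; mb = canonical b pre c suf
      in (pos ma && pos mb) , (neg ma || neg mb) , ma , mb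
    canonical (¬' a)     pre c suf = let ma = canonical a pre c suf in neg ma , pos ma , ma
    canonical (a U[ I ] b) pre c suf =
      let (p , n) = untilValues a b pre c suf in p , n , canonical a pre c suf , canonical b pre c suf
    canonical (a S[ I ] b) pre c suf =
      let (p , n) = sinceValues a b pre c suf in p , n , canonical a pre c suf , canonical b pre c suf

    untilValues : QF k → QF k → List Col → Col → List Col → Bool × Bool
    untilValues a b pre c []          = false , true
    untilValues a b pre c (c′ ∷ suf) =
      let ma = canonical a (c ∷ pre) c′ suf ; mb = canonical b (c ∷ pre) c′ suf
          (p , n) = untilValues a b (c ∷ pre) c′ suf
      in unfold⁺ (isLive bs c′) (pos ma) (pos mb) p , unfold⁻ (isLive bs c′) (neg ma) (neg mb) n

    sinceValues : QF k → QF k → List Col → Col → List Col → Bool × Bool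
    sinceValues a b []         c suf = false , true
    sinceValues a b (c′ ∷ pre) c suf =
      let ma = canonical a pre c′ (c ∷ suf) ; mb = canonical b pre c′ (c ∷ suf)
          (p , n) = sinceValues a b pre c′ (c ∷ suf)
      in unfold⁺ (isLive bs c′) (pos ma) (pos mb) p , unfold⁻ (isLive bs c′) (neg ma) (neg mb) n

  canonical-local : ∀ ψ pre c suf → Local c ψ (canonical ψ pre c suf)
  canonical-local true         pre c suf = refl , refl
  canonical-local true[ π ]    pre c suf = refl , refl
  canonical-local (prop p π)   pre c suf = refl , refl
  canonical-local (a ∧ b)      pre c suf = refl , refl , canonical-local a pre c suf , canonical-local b pre c suf
  canonical-local (¬' a)       pre c suf = refl , refl , canonical-local a pre c suf
  canonical-local (a U[ I ] b) pre c suf = canonical-local a pre c suf , canonical-local b pre c suf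
  canonical-local (a S[ I ] b) pre c suf = canonical-local a pre c suf , canonical-local b pre c suf

  canonical-step : ∀ ψ pre c c′ suf →
    Step ψ (isLive bs c) (canonical ψ pre c (c′ ∷ suf)) (isLive bs c′) (canonical ψ (c ∷ pre) c′ suf)
  canonical-step true         pre c c′ suf = tt
  canonical-step true[ π ]    pre c c′ suf = tt
  canonical-step (prop p π)   pre c c′ suf = tt
  canonical-step (a ∧ b)      pre c c′ suf = canonical-step a pre c c′ suf , canonical-step b pre c c′ suf
  canonical-step (¬' a)       pre c c′ suf = canonical-step a pre c c′ suf
  canonical-step (a U[ I ] b) pre c c′ suf = refl , refl , canonical-step a pre c c′ suf , canonical-step b pre c c′ suf
  canonical-step (a S[ I ] b) pre c c′ suf = refl , refl , canonical-step a pre c c′ suf , canonical-step b pre c c′ suf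

  canonical-first : ∀ ψ c suf → First ψ (canonical ψ [] c suf)
  canonical-first true         c suf = tt
  canonical-first true[ π ]    c suf = tt
  canonical-first (prop p π)   c suf = tt
  canonical-first (a ∧ b)      c suf = canonical-first a c suf , canonical-first b c suf
  canonical-first (¬' a)       c suf = canonical-first a c suf
  canonical-first (a U[ I ] b) c suf = canonical-first a c suf , canonical-first b c suf
  canonical-first (a S[ I ] b) c suf = refl , refl , canonical-first a c suf , canonical-first b c suf

  canonical-last : ∀ ψ pre c → Last ψ (canonical ψ pre c [])
  canonical-last true         pre c = tt
  canonical-last true[ π ]    pre c = tt
  canonical-last (prop p π)   pre c = tt
  canonical-last (a ∧ b)      pre c = canonical-last a pre c , canonical-last b pre c
  canonical-last (¬' a)       pre c = canonical-last a pre c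
  canonical-last (a U[ I ] b) pre c = refl , refl , canonical-last a pre c , canonical-last b pre c
  canonical-last (a S[ I ] b) pre c = canonical-last a pre c , canonical-last b pre c

  data Child : QF k → QF k → Set where
    ∧ˡ : ∀ {a b} → Child a (a ∧ b)
    ∧ʳ : ∀ {a b} → Child b (a ∧ b)
    ¬  : ∀ {a} → Child a (¬' a)
    Uˡ : ∀ {a I b} → Child a (a U[ I ] b)
    Uʳ : ∀ {a I b} → Child b (a U[ I ] b)
    Sˡ : ∀ {a I b} → Child a (a S[ I ] b)
    Sʳ : ∀ {a I b} → Child b (a S[ I ] b)

  project : ∀ {φ ψ} → Child φ ψ → Mark ψ → Mark φ
  project ∧ˡ = left
  project ∧ʳ = right
  project ¬  = proj₂ ∘ proj₂
  project Uˡ = left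
  project Uʳ = right
  project Sˡ = left
  project Sʳ = right

  project-Local : ∀ {φ ψ c m} (ch : Child φ ψ) → Local c ψ m → Local c φ (project ch m)
  project-Local ∧ˡ (_ , _ , l , _) = l
  project-Local ∧ʳ (_ , _ , _ , l) = l
  project-Local ¬  (_ , _ , l)     = l
  project-Local Uˡ (l , _)         = l
  project-Local Uʳ (_ , l)         = l
  project-Local Sˡ (l , _)         = l
  project-Local Sʳ (_ , l)         = l

  project-Step : ∀ {φ ψ l m l′ m′} (ch : Child φ ψ) → Step ψ l m l′ m′ → Step φ l (project ch m) l′ (project ch m′)
  project-Step ∧ˡ (s , _)         = s
  project-Step ∧ʳ (_ , s)         = s
  project-Step ¬  s               = s
  project-Step Uˡ (_ , _ , s , _) = s
  project-Step Uʳ (_ , _ , _ , s) = s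
  project-Step Sˡ (_ , _ , s , _) = s
  project-Step Sʳ (_ , _ , _ , s) = s

  project-First : ∀ {φ ψ m} (ch : Child φ ψ) → First ψ m → First φ (project ch m)
  project-First ∧ˡ (f , _)         = f
  project-First ∧ʳ (_ , f)         = f
  project-First ¬  f               = f
  project-First Uˡ (f , _)         = f
  project-First Uʳ (_ , f)         = f
  project-First Sˡ (_ , _ , f , _) = f
  project-First Sʳ (_ , _ , _ , f) = f

  project-Last : ∀ {φ ψ m} (ch : Child φ ψ) → Last ψ m → Last φ (project ch m)
  project-Last ∧ˡ (f , _)         = f
  project-Last ∧ʳ (_ , f)         = f
  project-Last ¬  f               = f
  project-Last Uˡ (_ , _ , f , _) = f
  project-Last Uʳ (_ , _ , _ , f) = f
  project-Last Sˡ (f , _)         = f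
  project-Last Sʳ (_ , f)         = f

untimed-∈I : ∀ {I} → IsZeroInfty I → ∀ {t t′} → t < t′ → (t′ - t) ∈I I
untimed-∈I {interval _ _ _ _} (refl , refl , refl) {t} {t′} t<t′ =
  subst (_≤ t′ - t) (ℚ.+-inverseʳ t) (ℚ.+-monoˡ-≤ (- t) (ℚ.<⇒≤ t<t′)) , _

module UntimedTemporal {k : ℕ} (Π : Assignment k) (a b : QF k) where

  _>_ : ℚ → ℚ → Set
  t > t′ = t′ < t

  module Future = Until _<_ ℚ.<-trans (ℚ.<-irrefl refl) (Live Π) (Sat⁺ Π a) (Sat⁻ Π a) (Sat⁺ Π b) (Sat⁻ Π b)
  module Past = Until _>_ (λ p q → ℚ.<-trans q p) (ℚ.<-irrefl refl) (Live Π) (Sat⁺ Π a) (Sat⁻ Π a) (Sat⁺ Π b) (Sat⁻ Π b)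

  module _ {I : Interval} (untimed : IsZeroInfty I) {t : ℚ} where

    until⁺ : Future.U⁺ t ⇔ Sat⁺ Π (a U[ I ] b) t
    until⁺ = mk⇔ (λ (t′ , t<t′ , live , sb , sa) → t′ , t<t′ , untimed-∈I untimed t<t′ , live , sb , sa)
                 (λ (t′ , t<t′ , _ , live , sb , sa) → t′ , t<t′ , live , sb , sa)

    until⁻ : Future.U⁻ t ⇔ Sat⁻ Π (a U[ I ] b) t
    until⁻ = mk⇔ (λ u t′ t<t′ _ live → u t′ t<t′ live) (λ u t′ t<t′ live → u t′ t<t′ (untimed-∈I untimed t<t′) live)

    since⁺ : Past.U⁺ t ⇔ Sat⁺ Π (a S[ I ] b) t
    since⁺ = mk⇔ (λ (t′ , t′<t , live , sb , sa) → t′ , t′<t , untimed-∈I untimed t′<t , live , sb , λ s t′<s s<t → sa s s<t t′<s)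
                 (λ (t′ , t′<t , _ , live , sb , sa) → t′ , t′<t , live , sb , λ s s<t t′<s → sa s t′<s s<t)

    since⁻ : Past.U⁻ t ⇔ Sat⁻ Π (a S[ I ] b) t
    since⁻ = mk⇔ (λ u t′ t′<t _ live → map₂ swap (u t′ t′<t live))
                 (λ u t′ t′<t live → map₂ swap (u t′ t′<t (untimed-∈I untimed t′<t) live))
      where
      swap : ∀ {P Q : ℚ → Set} → (∃ λ s → P s × Q s × Live Π s × Sat⁻ Π a s) → (∃ λ s → Q s × P s × Live Π s × Sat⁻ Π a s)
      swap (s , p , q , r) = s , q , p , r

module Consistency (k : ℕ) (bs : List Var) where
  open MergedWords k
  open Markings k bs

  module _ {E : Set} (col : E → Col) where

    data ConsistentAfter (ψ : QF k) (mk : E → Mark ψ) : Bool → Mark ψ → List E → Set where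
      end  : ∀ {l m} → Last ψ m → ConsistentAfter ψ mk l m []
      next : ∀ {l m e es} → Local (col e) ψ (mk e) → Step ψ l m (isLive bs (col e)) (mk e) →
             ConsistentAfter ψ mk (isLive bs (col e)) (mk e) es → ConsistentAfter ψ mk l m (e ∷ es)

    Consistent : ∀ ψ → (E → Mark ψ) → E → List E → Set
    Consistent ψ mk e es = Local (col e) ψ (mk e) × First ψ (mk e) × ConsistentAfter ψ mk (isLive bs (col e)) (mk e) es

    ConsistentAfter-project : ∀ {φ ψ mk l m es} (ch : Child φ ψ) →
      ConsistentAfter ψ mk l m es → ConsistentAfter φ (project ch ∘ mk) l (project ch m) es
    ConsistentAfter-project ch (end la)        = end (project-Last ch la)
    ConsistentAfter-project ch (next lo st ca) = next (project-Local ch lo) (project-Step ch st) (ConsistentAfter-project ch ca)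

    Consistent-project : ∀ {φ ψ mk e es} (ch : Child φ ψ) → Consistent ψ mk e es → Consistent φ (project ch ∘ mk) e es
    Consistent-project ch (lo , fi , ca) = project-Local ch lo , project-First ch fi , ConsistentAfter-project ch ca

    Consistent-local : ∀ {ψ mk e es} → Consistent ψ mk e es → ∀ x → x ∈ e ∷ es → Local (col x) ψ (mk x)
    Consistent-local (lo , _ , ca) = go lo ca
      where
      go : ∀ {ψ mk e l es} → Local (col e) ψ (mk e) → ConsistentAfter ψ mk l (mk e) es →
           ∀ x → x ∈ e ∷ es → Local (col x) ψ (mk x)
      go lo ca              x (here refl) = lo
      go lo (next lo′ _ ca) x (there x∈)  = go lo′ ca x x∈

  module Correctness {Π : Assignment k} {W : Stamped Col} (rep : Represents bs W Π) (sorted : Sorted W)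
    {E : Set} (col : E → Col) (time : E → ℚ) (e₀ : E) (es₀ : List E)
    (ascending : Linked (λ x y → time x < time y) (e₀ ∷ es₀))
    (covers : ∀ t → Live Π t → Any (λ x → time x ≡ t) (e₀ ∷ es₀))
    (in-W : ∀ x → x ∈ e₀ ∷ es₀ → (col x , time x) ∈ W) where

    open Reflection rep sorted

    Correct : ∀ ψ → (E → Mark ψ) → E → Set
    Correct ψ mk x = Reflects (Sat⁺ Π ψ (time x)) (pos (mk x)) × Reflects (Sat⁻ Π ψ (time x)) (neg (mk x))

    module _ {a b : QF k} {I : Interval} (untimed : IsZeroInfty I) (mk : E → Mark (a U[ I ] b))
             (ra : ∀ x → x ∈ e₀ ∷ es₀ → Correct a (left ∘ mk) x)
             (rb : ∀ x → x ∈ e₀ ∷ es₀ → Correct b (right ∘ mk) x) where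
      open UntimedTemporal Π a b
      open Future.Chains time (isLive bs ∘ col) (pos ∘ left ∘ mk) (neg ∘ left ∘ mk)
                         (pos ∘ right ∘ mk) (neg ∘ right ∘ mk) (pos ∘ mk) (neg ∘ mk)

      until-chain : ∀ {e es} → ConsistentAfter col (a U[ I ] b) mk (isLive bs (col e)) (mk e) es →
                    Linked (λ x y → time x < time y) (e ∷ es) → Chain e es
      until-chain (end (p , n , _))       _            = end p n
      until-chain (next _ (p , n , _) ca) (e<e′ ∷ asc) = next e<e′ p n (until-chain ca asc)

      until-correct : Consistent col (a U[ I ] b) mk e₀ es₀ → ∀ x → x ∈ e₀ ∷ es₀ → Correct (a U[ I ] b) mk x
      until-correct (_ , _ , ca) x x∈ =
        let (u⁺ , u⁻) = chain-outputs (until-chain ca ascending) inputs covers x x∈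
        in Reflects-⇔ (until⁺ untimed) u⁺ , Reflects-⇔ (until⁻ untimed) u⁻
        where
        inputs : ∀ x → x ∈ es₀ → Inputs x
        inputs x x∈ = let (a⁺ , a⁻) = ra x (there x∈) ; (b⁺ , b⁻) = rb x (there x∈)
                      in Live-reflects (in-W x (there x∈)) , a⁺ , a⁻ , b⁺ , b⁻

    module _ {a b : QF k} {I : Interval} (untimed : IsZeroInfty I) (mk : E → Mark (a S[ I ] b))
             (ra : ∀ x → x ∈ e₀ ∷ es₀ → Correct a (left ∘ mk) x)
             (rb : ∀ x → x ∈ e₀ ∷ es₀ → Correct b (right ∘ mk) x) where
      open UntimedTemporal Π a b
      open Past.Chains time (isLive bs ∘ col) (pos ∘ left ∘ mk) (neg ∘ left ∘ mk)
                       (pos ∘ right ∘ mk) (neg ∘ right ∘ mk) (pos ∘ mk) (neg ∘ mk)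

      -- Since is Until for the reversed order, so the chain of marks is read backwards.
      reversed-chain : ∀ {e acc es} → Chain e acc →
                       ConsistentAfter col (a S[ I ] b) mk (isLive bs (col e)) (mk e) es →
                       Linked (λ x y → time x < time y) (e ∷ es) →
                       ∃₂ λ h hs → h ∷ hs ≡ reverseAcc (e ∷ acc) es × Chain h hs
      reversed-chain ch (end _)                 _            = _ , _ , refl , ch
      reversed-chain ch (next _ (p , n , _) ca) (e<e′ ∷ asc) = reversed-chain (next e<e′ p n ch) ca asc

      since-correct : Consistent col (a S[ I ] b) mk e₀ es₀ → ∀ x → x ∈ e₀ ∷ es₀ → Correct (a S[ I ] b) mk x
      since-correct (_ , (p , n , _) , ca) x x∈ with reversed-chain (end p n) ca ascending
      ... | h , hs , eq , ch =
        let (u⁺ , u⁻) = chain-outputs ch (λ y y∈ → inputs y (reverse⁻ (subst (y ∈_) eq (there y∈))))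
                          (λ t live → subst (Any _) (sym eq) (reverse⁺ (covers t live)))
                          x (subst (x ∈_) (sym eq) (reverse⁺ x∈))
        in Reflects-⇔ (since⁺ untimed) u⁺ , Reflects-⇔ (since⁻ untimed) u⁻
        where
        inputs : ∀ x → x ∈ e₀ ∷ es₀ → Inputs x
        inputs x x∈ = let (a⁺ , a⁻) = ra x x∈ ; (b⁺ , b⁻) = rb x x∈
                      in Live-reflects (in-W x x∈) , a⁺ , a⁻ , b⁺ , b⁻

    consistent⇒correct : ∀ ψ → QFUntimed ψ → (mk : E → Mark ψ) → Consistent col ψ mk e₀ es₀ →
                         ∀ x → x ∈ e₀ ∷ es₀ → Correct ψ mk x
    consistent⇒correct true _ mk c x x∈ with Consistent-local col c x x∈
    ... | p , n = Reflects-≡ p (Live-reflects (in-W x x∈)) , Reflects-≡ n (¬-reflects (Live-reflects (in-W x x∈)))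
    consistent⇒correct true[ π ] _ mk c x x∈ with Consistent-local col c x x∈
    ... | p , n = Reflects-≡ p (LiveAt-reflects π (in-W x x∈)) , Reflects-≡ n (¬-reflects (LiveAt-reflects π (in-W x x∈)))
    consistent⇒correct (prop q π) _ mk c x x∈ with Consistent-local col c x x∈
    ... | p , n = Reflects-≡ p (PropAt-reflects true q π (in-W x x∈)) , Reflects-≡ n (PropAt-reflects false q π (in-W x x∈))
    consistent⇒correct (a ∧ b) (ua , ub) mk c x x∈ with Consistent-local col c x x∈
    ... | p , n , _ = Reflects-≡ p (proj₁ ra ×-reflects proj₁ rb) , Reflects-≡ n (proj₂ ra ⊎-reflects proj₂ rb)
      where
      ra : Correct a (project ∧ˡ ∘ mk) x
      ra = consistent⇒correct a ua _ (Consistent-project col ∧ˡ c) x x∈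
      rb : Correct b (project ∧ʳ ∘ mk) x
      rb = consistent⇒correct b ub _ (Consistent-project col ∧ʳ c) x x∈
    consistent⇒correct (¬' a) ua mk c x x∈ with Consistent-local col c x x∈
    ... | p , n , _ = Reflects-≡ p (proj₂ ra) , Reflects-≡ n (proj₁ ra)
      where
      ra : Correct a (project ¬ ∘ mk) x
      ra = consistent⇒correct a ua _ (Consistent-project col ¬ c) x x∈
    consistent⇒correct (a U[ I ] b) (untimed , ua , ub) mk c =
      until-correct untimed mk (consistent⇒correct a ua _ (Consistent-project col Uˡ c))
                               (consistent⇒correct b ub _ (Consistent-project col Uʳ c)) c
    consistent⇒correct (a S[ I ] b) (untimed , ua , ub) mk c =
      since-correct untimed mk (consistent⇒correct a ua _ (Consistent-project col Sˡ c))
                               (consistent⇒correct b ub _ (Consistent-project col Sʳ c)) c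

module MarkingAutomaton (k : ℕ) (bs : List Var) (ψ : QF k) where
  open MergedWords k
  open Markings k bs
  open Consistency k bs

  State : Set
  State = Maybe (Bool × Mark ψ)

  Move : State → Col → State → Set
  Move nothing          c (just (l , m)) = l ≡ isLive bs c × Local c ψ m × First ψ m × pos m ≡ true
  Move (just (l′ , m′)) c (just (l , m)) = l ≡ isLive bs c × Local c ψ m × Step ψ l′ m′ l m
  Move _                c nothing        = ⊥

  Move? : ∀ q c q′ → Dec (Move q c q′)
  Move? nothing          c (just (l , m)) = (l Bool.≟ _) ×-dec Local? c ψ m ×-dec First? ψ m ×-dec (pos m Bool.≟ true)
  Move? (just (l′ , m′)) c (just (l , m)) = (l Bool.≟ _) ×-dec Local? c ψ m ×-dec Step? ψ l′ m′ l m
  Move? nothing          c nothing        = no λ ()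
  Move? (just _)         c nothing        = no λ ()

  Accepting : State → Set
  Accepting nothing        = ⊥
  Accepting (just (_ , m)) = Last ψ m

  Accepting? : ∀ q → Dec (Accepting q)
  Accepting? nothing        = no λ ()
  Accepting? (just (_ , m)) = Last? ψ m

  automaton : NFA Col
  automaton = record
    { Q = State ; Q-finite = Maybe-finite (×-finite Bool-finite (Mark-finite ψ))
    ; Initial = _≡ nothing ; Initial? = λ q → Maybe.≡-dec (Finite._≟_ (×-finite Bool-finite (Mark-finite ψ))) q nothing
    ; Step = Move ; Step? = Move? ; Final = Accepting ; Final? = Accepting? }

  Position : Set
  Position = (Col × ℚ) × Mark ψ

  col : Position → Col
  col = proj₁ ∘ proj₁

  time : Position → ℚ
  time = proj₂ ∘ proj₁

  run⇒consistent : ∀ {l m} R → Run automaton (just (l , m)) (map proj₁ R) →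
                   ∃ λ P → map proj₁ P ≡ R × ConsistentAfter col ψ proj₂ l m P
  run⇒consistent []      (done la) = [] , refl , end la
  run⇒consistent (x ∷ R) (_∷_ {q′ = just (_ , m′)} (refl , lo , st) r) =
    let (P , eq , ca) = run⇒consistent R r in (x , m′) ∷ P , cong (x ∷_) eq , next lo st ca

  consistent⇒run : ∀ {l m} P → ConsistentAfter col ψ proj₂ l m P → Run automaton (just (l , m)) (map proj₁ (map proj₁ P))
  consistent⇒run []      (end la)        = done la
  consistent⇒run (_ ∷ P) (next lo st ca) = (refl , lo , st) ∷ consistent⇒run P ca

  canonicalMarking : List Col → List (Col × ℚ) → List Position
  canonicalMarking pre []            = []
  canonicalMarking pre ((c , t) ∷ R) = ((c , t) , canonical ψ pre c (map proj₁ R)) ∷ canonicalMarking (c ∷ pre) R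

  canonicalMarking-positions : ∀ pre R → map proj₁ (canonicalMarking pre R) ≡ R
  canonicalMarking-positions pre []            = refl
  canonicalMarking-positions pre ((c , t) ∷ R) = cong ((c , t) ∷_) (canonicalMarking-positions (c ∷ pre) R)

  canonicalMarking-consistent : ∀ pre c R →
    ConsistentAfter col ψ proj₂ (isLive bs c) (canonical ψ pre c (map proj₁ R)) (canonicalMarking (c ∷ pre) R)
  canonicalMarking-consistent pre c []             = end (canonical-last ψ pre c)
  canonicalMarking-consistent pre c ((c′ , _) ∷ R) =
    next (canonical-local ψ (c ∷ pre) c′ (map proj₁ R)) (canonical-step ψ pre c c′ (map proj₁ R))
         (canonicalMarking-consistent (c ∷ pre) c′ R)

  module Language {Π : Assignment k} {c₀ : Col} {R : Stamped Col} (rep : Represents bs ((c₀ , 0ℚ) ∷ R) Π) (sorted : Sorted ((c₀ , 0ℚ) ∷ R))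
                 (untimed : QFUntimed ψ) where
    open Reflection rep sorted

    correct-at-0 : ∀ m P → map proj₁ P ≡ R → Consistent col ψ proj₂ ((c₀ , 0ℚ) , m) P →
                   Reflects (Sat⁺ Π ψ 0ℚ) (pos m)
    correct-at-0 m P eq c = proj₁ (consistent⇒correct ψ untimed proj₂ c _ (here refl))
      where
      L : List Position
      L = ((c₀ , 0ℚ) , m) ∷ P
      L≡ : map proj₁ L ≡ (c₀ , 0ℚ) ∷ R
      L≡ = cong (_ ∷_) eq
      ascending : Linked (λ x y → time x < time y) L
      ascending = Linked.map⁻ (subst Sorted (sym L≡) sorted)
      covers : ∀ t → Live Π t → Any (λ x → time x ≡ t) L
      covers t live with Live⇒column live
      ... | c , c∈ , _ with ∈-map⁻ proj₁ (subst ((c , t) ∈_) (sym L≡) c∈)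
      ...   | x , x∈ , refl = lose x∈ refl
      in-W : ∀ x → x ∈ L → (col x , time x) ∈ (c₀ , 0ℚ) ∷ R
      in-W x x∈ = subst (proj₁ x ∈_) L≡ (∈-map⁺ proj₁ x∈)
      open Consistency.Correctness k bs rep sorted col time _ P ascending covers in-W

    accepts⇒sat : Accepts automaton (c₀ ∷ map proj₁ R) → Sat⁺ Π ψ 0ℚ
    accepts⇒sat (_ , refl , _∷_ {q′ = just (_ , m)} (refl , lo , fi , pos≡) r) =
      let (P , eq , ca) = run⇒consistent R r
      in Equivalence.to (Reflects⇒T⇔ (correct-at-0 m P eq (lo , fi , ca))) (subst T (sym pos≡) tt)

    sat⇒accepts : Sat⁺ Π ψ 0ℚ → Accepts automaton (c₀ ∷ map proj₁ R)
    sat⇒accepts s = nothing , refl , (refl , canonical-local ψ [] c₀ _ , canonical-first ψ c₀ _ , pos≡) ∷ run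
      where
      m : Mark ψ
      m = canonical ψ [] c₀ (map proj₁ R)
      P : List Position
      P = canonicalMarking (c₀ ∷ []) R
      P≡ : map proj₁ P ≡ R
      P≡ = canonicalMarking-positions (c₀ ∷ []) R
      consistent : ConsistentAfter col ψ proj₂ (isLive bs c₀) m P
      consistent = canonicalMarking-consistent [] c₀ R
      pos≡ : pos m ≡ true
      pos≡ = Equivalence.to Bool.T-≡ (Equivalence.from (Reflects⇒T⇔
               (correct-at-0 m P P≡ (canonical-local ψ [] c₀ _ , canonical-first ψ c₀ _ , consistent))) s)
      run : Run automaton (just (isLive bs c₀ , m)) (map proj₁ R)
      run = subst (Run automaton _) (cong (map proj₁) P≡) (consistent⇒run P consistent)

-- Quantifiers

module Extensions (k : ℕ) where
  open MergedWords k

  ∅ : ∀ {n} → Column n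
  ∅ = Vec.replicate _ nothing

  padding : ∀ {n} → Maybe (Letter k) → Column (suc n)
  padding x = x ∷ ∅

  newRow : ∀ {n} → Stamped (Column (suc n)) → Stamped (Letter k)
  newRow = rowOf Vec.head

  module _ {n : ℕ} where

    data TimedExtends : Stamped (Column (suc n)) → Stamped (Column n) → Set where
      []  : TimedExtends [] []
      pad : ∀ x t {W′ W} → TimedExtends W′ W → TimedExtends ((padding x , t) ∷ W′) W
      ext : ∀ x {c t W′ W} → TimedExtends W′ W → TimedExtends ((x ∷ c , t) ∷ W′) ((c , t) ∷ W)

  cell-new : ∀ π bs x (c : Column (length bs)) → cell (π ∷ bs) π (x ∷ c) ≡ x
  cell-new π bs x c with π ℕ.≟ π
  ... | yes _ = refl
  ... | no π≢π = ⊥-elim (π≢π refl)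

  cell-old : ∀ {π π′} bs x (c : Column (length bs)) → π′ ≢ π → cell (π ∷ bs) π′ (x ∷ c) ≡ cell bs π′ c
  cell-old {π} {π′} bs x c π′≢π with π′ ℕ.≟ π
  ... | yes π′≡π = ⊥-elim (π′≢π π′≡π)
  ... | no _     = refl

  cell-∅ : ∀ bs π → cell bs π ∅ ≡ nothing
  cell-∅ []       π = refl
  cell-∅ (b ∷ bs) π with π ℕ.≟ b
  ... | yes _ = refl
  ... | no  _ = cell-∅ bs π

  row-new : ∀ π bs (W′ : Stamped (Column (suc (length bs)))) → row (π ∷ bs) π W′ ≡ newRow W′
  row-new π bs []                  = refl
  row-new π bs ((x ∷ c , t) ∷ W′) rewrite cell-new π bs x c = cong (prepend x t) (row-new π bs W′)

  row-old : ∀ {π π′} bs {W′ W} → π′ ≢ π → TimedExtends W′ W → row (π ∷ bs) π′ W′ ≡ row bs π′ W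
  row-old bs π′≢π [] = refl
  row-old {π′ = π′} bs π′≢π (pad x t e) rewrite cell-old bs x ∅ π′≢π | cell-∅ bs π′ = row-old bs π′≢π e
  row-old {π′ = π′} bs π′≢π (ext x {c} {t} e) rewrite cell-old bs x c π′≢π = cong (prepend (cell bs π′ c) t) (row-old bs π′≢π e)

  Represents-extend : ∀ {bs W W′ Π π ρ} → Represents bs W Π → TimedExtends W′ W → events ρ ≡ newRow W′ →
                      Represents (π ∷ bs) W′ (Π [ π ↦ ρ ])
  Represents-extend {bs} {W} {W′} {Π} {π} {ρ} rep e ev = mkRepresents agree
    where
    agree : ∀ π′ → Agrees ((Π [ π ↦ ρ ]) π′) (isBound (π ∷ bs) π′) (row (π ∷ bs) π′ W′)
    agree π′ with π′ ℕ.≟ π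
    ... | yes refl = trans ev (sym (row-new π bs W′))
    ... | no π′≢π rewrite row-old bs π′≢π e = agrees rep π′

  data Above {X : Set} (a : ℚ) : Stamped X → Set where
    []  : Above a []
    _∷_ : ∀ {c t W} → a < t → Above t W → Above a ((c , t) ∷ W)

  Above⇒Sorted : ∀ {X} {c : X} {a W} → Above a W → Sorted ((c , a) ∷ W)
  Above⇒Sorted []         = [-]
  Above⇒Sorted (a<t ∷ ab) = a<t ∷ Above⇒Sorted ab

  Increasing⇒Above : ∀ {X : Set} {a x t} {es : Stamped X} → a < t → Increasing ((x , t) ∷ es) → Above a ((x , t) ∷ es)
  Increasing⇒Above a<t inc[x]          = a<t ∷ []
  Increasing⇒Above a<t (inc∷ t<t′ inc) = a<t ∷ Increasing⇒Above t<t′ inc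

  newRow-above : ∀ {n a} (W′ : Stamped (Column (suc n))) → Above a W′ →
                 Increasing (newRow W′) × All (λ e → a < proj₂ e) (newRow W′)
  newRow-above []                          []          = inc[] , []
  newRow-above ((nothing ∷ c , t) ∷ W′) (a<t ∷ ab) =
    let (inc , above) = newRow-above W′ ab in inc , All.map (ℚ.<-trans a<t) above
  newRow-above ((just σ ∷ c , t) ∷ W′)  (a<t ∷ ab) =
    let (inc , above) = newRow-above W′ ab in cons inc above , a<t ∷ All.map (ℚ.<-trans a<t) above
    where
    cons : ∀ {es} → Increasing es → All (λ e → t < proj₂ e) es → Increasing ((σ , t) ∷ es)
    cons {[]}    _   _          = inc[x]
    cons {_ ∷ _} inc (t<t′ ∷ _) = inc∷ t<t′ inc

  module _ {n : ℕ} where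

    mutual
      merge : Stamped (Column n) → Stamped (Letter k) → Stamped (Column (suc n))
      merge []            []             = []
      merge []            ((σ , t) ∷ es) = (just σ ∷ ∅ , t) ∷ merge [] es
      merge ((c , t) ∷ W) es             = insert c t W es

      insert : Column n → ℚ → Stamped (Column n) → Stamped (Letter k) → Stamped (Column (suc n))
      insert c t W []               = (nothing ∷ c , t) ∷ merge W []
      insert c t W ((σ , t′) ∷ es) with ℚ.<-cmp t t′
      ... | tri< _ _ _ = (nothing ∷ c , t) ∷ merge W ((σ , t′) ∷ es)
      ... | tri≈ _ _ _ = (just σ ∷ c , t) ∷ merge W es
      ... | tri> _ _ _ = (just σ ∷ ∅ , t′) ∷ insert c t W es

    mutual
      merge-extends : ∀ W es → TimedExtends (merge W es) W
      merge-extends []            []             = []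
      merge-extends []            ((σ , t) ∷ es) = pad (just σ) t (merge-extends [] es)
      merge-extends ((c , t) ∷ W) es             = insert-extends c t W es

      insert-extends : ∀ c t W es → TimedExtends (insert c t W es) ((c , t) ∷ W)
      insert-extends c t W []               = ext nothing (merge-extends W [])
      insert-extends c t W ((σ , t′) ∷ es) with ℚ.<-cmp t t′
      ... | tri< _ _ _ = ext nothing (merge-extends W ((σ , t′) ∷ es))
      ... | tri≈ _ _ _ = ext (just σ) (merge-extends W es)
      ... | tri> _ _ _ = pad (just σ) t′ (insert-extends c t W es)

    mutual
      merge-newRow : ∀ W es → newRow (merge W es) ≡ es
      merge-newRow []            []             = refl
      merge-newRow []            ((σ , t) ∷ es) = cong ((σ , t) ∷_) (merge-newRow [] es)
      merge-newRow ((c , t) ∷ W) es             = insert-newRow c t W es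

      insert-newRow : ∀ c t W es → newRow (insert c t W es) ≡ es
      insert-newRow c t W []               = merge-newRow W []
      insert-newRow c t W ((σ , t′) ∷ es) with ℚ.<-cmp t t′
      ... | tri< _ _    _ = merge-newRow W ((σ , t′) ∷ es)
      ... | tri≈ _ refl _ = cong ((σ , t) ∷_) (merge-newRow W es)
      ... | tri> _ _    _ = cong ((σ , t′) ∷_) (insert-newRow c t W es)

    mutual
      merge-above : ∀ {a} W es → Above a W → Above a es → Above a (merge W es)
      merge-above []            []             _  _          = []
      merge-above []            ((σ , t) ∷ es) _  (a<t ∷ ab) = a<t ∷ merge-above [] es [] ab
      merge-above ((c , t) ∷ W) es             ab ab′        = insert-above c t W es ab ab′

      insert-above : ∀ {a} c t W es → Above a ((c , t) ∷ W) → Above a es → Above a (insert c t W es)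
      insert-above c t W []               (a<t ∷ ab) _            = a<t ∷ merge-above W [] ab []
      insert-above c t W ((σ , t′) ∷ es) (a<t ∷ ab) (a<t′ ∷ ab′) with ℚ.<-cmp t t′
      ... | tri< t<t′ _ _    = a<t ∷ merge-above W ((σ , t′) ∷ es) ab (t<t′ ∷ ab′)
      ... | tri≈ _    refl _ = a<t ∷ merge-above W es ab ab′
      ... | tri> _    _ t′<t = a<t′ ∷ insert-above c t W es (t′<t ∷ ab) ab′

    merge-head : ∀ c₀ R es → All (λ e → 0ℚ ≤ proj₂ e) es →
                 ∃₂ λ x₀ R′ → merge ((c₀ , 0ℚ) ∷ R) es ≡ (x₀ ∷ c₀ , 0ℚ) ∷ R′ × TimedExtends R′ R
    merge-head c₀ R []              _          = _ , _ , refl , merge-extends R []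
    merge-head c₀ R ((σ , t′) ∷ es) (0≤t′ ∷ _) with ℚ.<-cmp 0ℚ t′
    ... | tri< _ _ _    = _ , _ , refl , merge-extends R ((σ , t′) ∷ es)
    ... | tri≈ _ _ _    = _ , _ , refl , merge-extends R es
    ... | tri> _ _ t′<0 = ⊥-elim (ℚ.<-irrefl refl (ℚ.≤-<-trans 0≤t′ t′<0))

  module _ {n : ℕ} where
    open Projection {Column n} {Column (suc n)} _∷_ padding public
      using (Extends; Extends₀; []; pad; ext)

    TimedExtends⇒Extends : ∀ {W′ W} → TimedExtends W′ W → Extends (map proj₁ W′) (map proj₁ W)
    TimedExtends⇒Extends []          = []
    TimedExtends⇒Extends (pad x t e) = pad x (TimedExtends⇒Extends e)
    TimedExtends⇒Extends (ext x e)   = ext x (TimedExtends⇒Extends e)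

  fresh : ∀ {X : Set} a (R : Stamped X) → Above a R → ∃ λ t → a < t × Above t R
  fresh a []            []          = a + 1ℚ , a<a+1 , []
    where
    a<a+1 : a < a + 1ℚ
    a<a+1 = subst (_< a + 1ℚ) (ℚ.+-identityʳ a) (ℚ.+-monoʳ-< a (toWitness {a? = 0ℚ ℚ.<? 1ℚ} _))
  fresh a ((c , t) ∷ R) (a<t ∷ ab) = let (m , a<m , m<t) = ℚ.<-dense a<t in m , a<m , m<t ∷ ab

  realize : ∀ {n} a (R : Stamped (Column n)) {w′} → Above a R → Extends w′ (map proj₁ R) →
            ∃ λ R′ → Above a R′ × map proj₁ R′ ≡ w′ × TimedExtends R′ R
  realize a []            []          []        = [] , [] , refl , []
  realize a ((c , t) ∷ R) (a<t ∷ ab) (ext x e) with realize t R ab e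
  ... | R′ , ab′ , refl , e′ = (x ∷ c , t) ∷ R′ , a<t ∷ ab′ , refl , ext x e′
  realize a R ab (pad x e) with fresh a R ab
  ... | t , a<t , t-ab with realize t R t-ab e
  ...   | R′ , ab′ , refl , e′ = (padding x , t) ∷ R′ , a<t ∷ ab′ , refl , pad x t e′

  -1<0 : - 1ℚ < 0ℚ
  -1<0 = toWitness {a? = - 1ℚ ℚ.<? 0ℚ} _

  events-above : ∀ (ρ : TW k) → Above (- 1ℚ) (events ρ)
  events-above (tword []             _          _)   = []
  events-above (tword ((_ , t) ∷ _) (0≤t ∷ _) inc) = Increasing⇒Above (ℚ.<-≤-trans -1<0 0≤t) inc

  Entry-finite : Finite (Maybe (Letter k))
  Entry-finite = Maybe-finite (Vec-finite Bool-finite k)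

  ∃-projection : ∀ {n} → NFA (Column (suc n)) → NFA (Column n)
  ∃-projection = Projection.projection _∷_ padding Entry-finite

module Synchrony (k : ℕ) where
  open MergedWords k
  open Extensions k

  -- Comparing with one bound trace suffices, since the bound traces share their timestamps.
  Synchronous : Mode → ∀ {n} → Column (suc n) → Set
  Synchronous async _           = ⊤
  Synchronous sync  (x ∷ [])    = ⊤
  Synchronous sync  (x ∷ y ∷ _) = is-just x ≡ is-just y

  Synchronous? : ∀ md {n} (c : Column (suc n)) → Dec (Synchronous md c)
  Synchronous? async _           = yes tt
  Synchronous? sync  (x ∷ [])    = yes tt
  Synchronous? sync  (x ∷ y ∷ _) = is-just x Bool.≟ is-just y

  SameStamps-refl : ∀ {ρ : TW k} → SameStamps ρ ρ
  SameStamps-refl t = (λ t∈ → t∈) , (λ t∈ → t∈)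

  SameStamps-sym : ∀ {ρ ρ′ : TW k} → SameStamps ρ ρ′ → SameStamps ρ′ ρ
  SameStamps-sym same t = proj₂ (same t) , proj₁ (same t)

  SameStamps-trans : ∀ {ρ ρ′ ρ″ : TW k} → SameStamps ρ ρ′ → SameStamps ρ′ ρ″ → SameStamps ρ ρ″
  SameStamps-trans same same′ t = proj₁ (same′ t) ∘ proj₁ (same t) , proj₂ (same t) ∘ proj₂ (same′ t)

  update-here : ∀ (Π : Assignment k) π ρ → (Π [ π ↦ ρ ]) π ≡ just ρ
  update-here Π π ρ with π ℕ.≟ π
  ... | yes _    = refl
  ... | no π≢π = ⊥-elim (π≢π refl)

  update-there : ∀ (Π : Assignment k) {π π′} ρ → π′ ≢ π → (Π [ π ↦ ρ ]) π′ ≡ Π π′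
  update-there Π {π} {π′} ρ π′≢π with π′ ℕ.≟ π
  ... | yes π′≡π = ⊥-elim (π′≢π π′≡π)
  ... | no _     = refl

  InRange-update : ∀ (Π : Assignment k) π ρ {ρ′} → InRange (Π [ π ↦ ρ ]) ρ′ → ρ′ ≡ ρ ⊎ InRange Π ρ′
  InRange-update Π π ρ (π′ , e) with π′ ℕ.≟ π
  ... | yes _ = inj₁ (sym (Maybe.just-injective e))
  ... | no  _ = inj₂ (π′ , e)

  Synchronised : Mode → Assignment k → Set
  Synchronised async Π = ⊤
  Synchronised sync  Π = ∀ ρ ρ′ → InRange Π ρ → InRange Π ρ′ → SameStamps ρ ρ′

  Synchronised-update : ∀ md {Π : Assignment k} π ρ → Synchronised md Π → Admissible md Π ρ →
                        Synchronised md (Π [ π ↦ ρ ])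
  Synchronised-update async π ρ _ _ = tt
  Synchronised-update sync {Π} π ρ synced adm ρ₁ ρ₂ r₁ r₂ with InRange-update Π π ρ r₁ | InRange-update Π π ρ r₂
  ... | inj₁ refl | inj₁ refl = SameStamps-refl {ρ}
  ... | inj₁ refl | inj₂ r₂′  = adm ρ₂ r₂′
  ... | inj₂ r₁′  | inj₁ refl = SameStamps-sym {ρ} {ρ₁} (adm ρ₁ r₁′)
  ... | inj₂ r₁′  | inj₂ r₂′  = synced ρ₁ ρ₂ r₁′ r₂′

  -- The column c₀ sits at time 0, where formulas are evaluated, whether or not a trace has an
  -- event there.
  record Encodes (md : Mode) (bs : List Var) (Π : Assignment k)
                 (c₀ : Column (length bs)) (R : Stamped (Column (length bs))) : Set where
    field
      above        : Above 0ℚ R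
      represents   : Represents bs ((c₀ , 0ℚ) ∷ R) Π
      synchronised : Synchronised md Π

    sorted : Sorted ((c₀ , 0ℚ) ∷ R)
    sorted = Above⇒Sorted above

  LiveAt-just : ∀ (Π : Assignment k) π {ρ t} → Π π ≡ just ρ → LiveAt Π π t ⇔ t ∈T ρ
  LiveAt-just Π π e = mk⇔ (λ (_ , e′ , t∈) → subst (_ ∈T_) (Maybe.just-injective (trans (sym e′) e)) t∈)
                          (λ t∈ → _ , e , t∈)

  module TwoTraces {b : Var} {bs : List Var} {π : Var} (b≢π : b ≢ π)
                   {Π : Assignment k} {ρ ρ-b : TW k} (Π-b : Π b ≡ just ρ-b)
                   {W′ : Stamped (Column (suc (suc (length bs))))}
                   (rep′ : Represents (π ∷ b ∷ bs) W′ (Π [ π ↦ ρ ])) (sorted′ : Sorted W′) where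
    open Reflection rep′ sorted′

    new-reflects : ∀ {x y c t} → (x ∷ y ∷ c , t) ∈ W′ → Reflects (t ∈T ρ) (is-just x)
    new-reflects {x} {y} {c} {t} c∈ =
      Reflects-⇔ (LiveAt-just (Π [ π ↦ ρ ]) π (update-here Π π ρ))
                 (subst (Reflects (LiveAt (Π [ π ↦ ρ ]) π t) ∘ is-just) (cell-new π (b ∷ bs) x (y ∷ c)) (LiveAt-reflects π c∈))

    old-reflects : ∀ {x y c t} → (x ∷ y ∷ c , t) ∈ W′ → Reflects (t ∈T ρ-b) (is-just y)
    old-reflects {x} {y} {c} {t} c∈ =
      Reflects-⇔ (LiveAt-just (Π [ π ↦ ρ ]) b (trans (update-there Π ρ b≢π) Π-b))
                 (subst (Reflects (LiveAt (Π [ π ↦ ρ ]) b t) ∘ is-just) (trans (cell-old (b ∷ bs) x (y ∷ c) b≢π) (cell-new b bs y c))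
                        (LiveAt-reflects b c∈))

    SameStamps⇒Synchronous : SameStamps ρ ρ-b → All (Synchronous sync) (map proj₁ W′)
    SameStamps⇒Synchronous same = All.map⁺ (All.tabulate synchronous)
      where
      synchronous : ∀ {e} → e ∈ W′ → Synchronous sync (proj₁ e)
      synchronous {(_ ∷ _ ∷ _) , t} e∈ = det (Reflects-⇔ (mk⇔ (proj₁ (same t)) (proj₂ (same t))) (new-reflects e∈)) (old-reflects e∈)

    Synchronous⇒SameStamps : All (Synchronous sync) (map proj₁ W′) → SameStamps ρ ρ-b
    Synchronous⇒SameStamps synchronous t = to , from
      where
      at : ∀ {e} → e ∈ W′ → Synchronous sync (proj₁ e)
      at = All.lookup (All.map⁻ synchronous)
      to : t ∈T ρ → t ∈T ρ-b
      to t∈ with stamp⇒cell {π} (update-here Π π ρ) t∈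
      ... | (x ∷ y ∷ c) , c∈ , _ =
        Equivalence.to (Reflects⇒T⇔ (old-reflects c∈))
          (subst T (at c∈) (Equivalence.from (Reflects⇒T⇔ (new-reflects c∈)) t∈))
      from : t ∈T ρ-b → t ∈T ρ
      from t∈ with stamp⇒cell {b} (trans (update-there Π ρ b≢π) Π-b) t∈
      ... | (x ∷ y ∷ c) , c∈ , _ =
        Equivalence.to (Reflects⇒T⇔ (new-reflects c∈))
          (subst T (sym (at c∈)) (Equivalence.from (Reflects⇒T⇔ (old-reflects c∈)) t∈))

  unbound : ∀ {W} {Π : Assignment k} {π ρ} → Represents [] W Π → Π π ≢ just ρ
  unbound {π = π} rep e = subst (λ x → Agrees x false _) e (agrees rep π)

  Admissible⇒Synchronous : ∀ md bs π → π ∉ bs → ∀ {Π : Assignment k} {W ρ W′} → Represents bs W Π →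
    Represents (π ∷ bs) W′ (Π [ π ↦ ρ ]) → Sorted W′ → Admissible md Π ρ → All (Synchronous md) (map proj₁ W′)
  Admissible⇒Synchronous async _        _ _  _   _    _       _   = All.universal (λ _ → tt) _
  Admissible⇒Synchronous sync  []       _ _  _   _    _       _   = All.universal (λ { (_ ∷ []) → tt }) _
  Admissible⇒Synchronous sync  (b ∷ bs) π π∉ rep rep′ sorted′ adm with represents-bound rep (isBound-here b bs)
  ... | ρ-b , Π-b = TwoTraces.SameStamps⇒Synchronous (λ b≡π → π∉ (here (sym b≡π))) Π-b rep′ sorted′ (adm ρ-b (b , Π-b))

  Synchronous⇒Admissible : ∀ md bs π → π ∉ bs → ∀ {Π : Assignment k} {W ρ W′} → Represents bs W Π → Synchronised md Π →
    Represents (π ∷ bs) W′ (Π [ π ↦ ρ ]) → Sorted W′ → All (Synchronous md) (map proj₁ W′) → Admissible md Π ρ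
  Synchronous⇒Admissible async _        _ _  _   _      _    _       _  = tt
  Synchronous⇒Admissible sync  []       _ _  rep _      _    _       _  ρ′ (_ , e) = ⊥-elim (unbound rep e)
  Synchronous⇒Admissible sync  (b ∷ bs) π π∉ {ρ = ρ} rep synced rep′ sorted′ sy ρ′ r′ with represents-bound rep (isBound-here b bs)
  ... | ρ-b , Π-b = SameStamps-trans {ρ} {ρ-b} {ρ′} (TwoTraces.Synchronous⇒SameStamps (λ b≡π → π∉ (here (sym b≡π))) Π-b rep′ sorted′ sy)
                                     (synced ρ-b ρ′ (b , Π-b) r′)

module Traces {k m : ℕ} (𝒜 : TA (Letter k) m 0) where
  open MergedWords k
  open Extensions k
  open Synchrony k

  Moves : Fin m → Maybe (Letter k) → Fin m → Set
  Moves s nothing  s′ = s ≡ s′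
  Moves s (just σ) s′ =
    Any (λ tr → Transition.source tr ≡ s × Transition.letter tr ≡ σ × Transition.target tr ≡ s′) (Δ 𝒜)

  Moves? : ∀ s x s′ → Dec (Moves s x s′)
  Moves? s nothing  s′ = s Fin.≟ s′
  Moves? s (just σ) s′ = Any.any? (λ tr → (Transition.source tr Fin.≟ s) ×-dec
                                       (Vec.≡-dec Bool._≟_ (Transition.letter tr) σ) ×-dec
                                       (Transition.target tr Fin.≟ s′)) (Δ 𝒜)

  rowAutomaton : Mode → ∀ n → NFA (Column (suc n))
  rowAutomaton md n = record
    { Q = Fin m ; Q-finite = Fin-finite m
    ; Initial = _≡ initial 𝒜 ; Initial? = λ s → s Fin.≟ initial 𝒜
    ; Step = λ s c s′ → Synchronous md c × Moves s (Vec.head c) s′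
    ; Step? = λ s c s′ → Synchronous? md c ×-dec Moves? s (Vec.head c) s′
    ; Final = λ s → accepting 𝒜 s ≡ true ; Final? = λ s → accepting 𝒜 s Bool.≟ true }

  guard-holds : ∀ (g : Guard 0) v → v ⊨g g
  guard-holds true-g    v = tt
  guard-holds (g ∧g h)  v = guard-holds g v , guard-holds h v
  guard-holds (atom () _ _) v

  module _ {md : Mode} {n : ℕ} where

    RunFrom⇒Run : ∀ {s v τ} (W′ : Stamped (Column (suc n))) → All (Synchronous md) (map proj₁ W′) →
                  RunFrom 𝒜 s v τ (newRow W′) → Run (rowAutomaton md n) s (map proj₁ W′)
    RunFrom⇒Run []                       []         (done acc) = done acc
    RunFrom⇒Run ((nothing ∷ _ , _) ∷ W′) (sy ∷ sys) r          = (sy , refl) ∷ RunFrom⇒Run W′ sys r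
    RunFrom⇒Run ((just σ ∷ _ , _) ∷ W′)  (sy ∷ sys) (step tr tr∈ src≡ σ≡ _ r) =
      (sy , lose tr∈ (src≡ , σ≡ , refl)) ∷ RunFrom⇒Run W′ sys r

    Run⇒RunFrom : ∀ {s v τ} (W′ : Stamped (Column (suc n))) → Run (rowAutomaton md n) s (map proj₁ W′) →
                  RunFrom 𝒜 s v τ (newRow W′)
    Run⇒RunFrom []                       (done acc)       = done acc
    Run⇒RunFrom ((nothing ∷ _ , _) ∷ W′) ((_ , refl) ∷ r) = Run⇒RunFrom W′ r
    Run⇒RunFrom ((just σ ∷ _ , _) ∷ W′)  ((_ , mv) ∷ r) with find mv
    ... | tr , tr∈ , src≡ , σ≡ , refl = step tr tr∈ src≡ σ≡ (guard-holds (Transition.guard tr) _) (Run⇒RunFrom W′ r)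

    Run⇒Synchronous : ∀ {s} (w′ : List (Column (suc n))) → Run (rowAutomaton md n) s w′ → All (Synchronous md) w′
    Run⇒Synchronous []       (done _)        = []
    Run⇒Synchronous (_ ∷ w′) ((sy , _) ∷ r) = sy ∷ Run⇒Synchronous w′ r

  module Quantifier (md : Mode) (bs : List Var) (π : Var) (π∉ : π ∉ bs)
                    {Π : Assignment k} {c₀ : Column (length bs)} {R : Stamped (Column (length bs))}
                    (enc : Encodes md bs Π c₀ R) where
    open Encodes enc

    trace⇒extension : ∀ ρ → ⟦ 𝒜 ⟧ ρ → Admissible md Π ρ → ∃₂ λ x₀ R′ →
      Extends₀ ((x₀ ∷ c₀) ∷ map proj₁ R′) (c₀ ∷ map proj₁ R) ×
      Accepts (rowAutomaton md (length bs)) ((x₀ ∷ c₀) ∷ map proj₁ R′) ×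
      Encodes md (π ∷ bs) (Π [ π ↦ ρ ]) (x₀ ∷ c₀) R′
    trace⇒extension ρ accepted adm with merge-head c₀ R (events ρ) (nonneg ρ)
    ... | x₀ , R′ , merged , ext-R =
      x₀ , R′ , ext x₀ (TimedExtends⇒Extends ext-R) , (initial 𝒜 , refl , run) , enc′
      where
      W′ : Stamped (Column (suc (length bs)))
      W′ = (x₀ ∷ c₀ , 0ℚ) ∷ R′
      events≡ : events ρ ≡ newRow W′
      events≡ = trans (sym (merge-newRow ((c₀ , 0ℚ) ∷ R) (events ρ))) (cong newRow merged)
      above′ : Above 0ℚ R′
      above′ with subst (Above _) merged (merge-above ((c₀ , 0ℚ) ∷ R) (events ρ) (-1<0 ∷ above) (events-above ρ))
      ... | _ ∷ ab = ab
      rep′ : Represents (π ∷ bs) W′ (Π [ π ↦ ρ ])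
      rep′ = Represents-extend represents (ext x₀ ext-R) events≡
      run : Run (rowAutomaton md (length bs)) (initial 𝒜) (map proj₁ W′)
      run = RunFrom⇒Run W′ (Admissible⇒Synchronous md bs π π∉ represents rep′ (Above⇒Sorted above′) adm)
                        (subst (RunFrom 𝒜 _ _ _) events≡ accepted)
      enc′ : Encodes md (π ∷ bs) (Π [ π ↦ ρ ]) (x₀ ∷ c₀) R′
      enc′ = record { above = above′ ; represents = rep′ ; synchronised = Synchronised-update md π ρ synchronised adm }

    extension⇒trace : ∀ {w′} → Extends₀ w′ (c₀ ∷ map proj₁ R) → Accepts (rowAutomaton md (length bs)) w′ →
      ∃ λ ρ → ⟦ 𝒜 ⟧ ρ × Admissible md Π ρ × ∃₂ λ x₀ R′ →
        w′ ≡ (x₀ ∷ c₀) ∷ map proj₁ R′ × Encodes md (π ∷ bs) (Π [ π ↦ ρ ]) (x₀ ∷ c₀) R′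
    extension⇒trace (ext x₀ e) (_ , refl , run) with realize 0ℚ R above e
    ... | R′ , above′ , refl , ext-R = ρ , Run⇒RunFrom W′ run , adm , x₀ , R′ , refl , enc′
      where
      W′ : Stamped (Column (suc (length bs)))
      W′ = (x₀ ∷ c₀ , 0ℚ) ∷ R′
      nonneg′ : ∀ x → All (λ e → 0ℚ ≤ proj₂ e) (prepend x 0ℚ (newRow R′))
      nonneg′ nothing  = All.map ℚ.<⇒≤ (proj₂ (newRow-above R′ above′))
      nonneg′ (just σ) = ℚ.≤-refl ∷ All.map ℚ.<⇒≤ (proj₂ (newRow-above R′ above′))
      ρ : TW k
      ρ = tword (newRow W′) (nonneg′ x₀) (proj₁ (newRow-above W′ (-1<0 ∷ above′)))
      rep′ : Represents (π ∷ bs) W′ (Π [ π ↦ ρ ])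
      rep′ = Represents-extend represents (ext x₀ ext-R) refl
      adm : Admissible md Π ρ
      adm = Synchronous⇒Admissible md bs π π∉ represents synchronised rep′ (Above⇒Sorted above′) (Run⇒Synchronous _ run)
      enc′ : Encodes md (π ∷ bs) (Π [ π ↦ ρ ]) (x₀ ∷ c₀) R′
      enc′ = record { above = above′ ; represents = rep′ ; synchronised = Synchronised-update md π ρ synchronised adm }

  module _ (md : Mode) (bs : List Var) (π : Var) (π∉ : π ∉ bs)
           {Π : Assignment k} {c₀ : Column (length bs)} {R : Stamped (Column (length bs))}
           (enc : Encodes md bs Π c₀ R) (D : DFA (Column (suc (length bs)))) (P : TW k → Set)
           (P⇔ : ∀ {ρ : TW k} {x₀ : Maybe (Letter k)} {R′ : Stamped (Column (suc (length bs)))} →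
                 Encodes md (π ∷ bs) (Π [ π ↦ ρ ]) (x₀ ∷ c₀) R′ → P ρ ⇔ DFA.Accepts D ((x₀ ∷ c₀) ∷ map proj₁ R′))
           where
    open Quantifier md bs π π∉ enc

    Accepts-∃ : DFA.Accepts (determinise (∃-projection (D ⊗ rowAutomaton md (length bs)))) (c₀ ∷ map proj₁ R) ⇔
                (∃ λ ρ → ⟦ 𝒜 ⟧ ρ × Admissible md Π ρ × P ρ)
    Accepts-∃ = mk⇔ to from
      where
      w : List (Column (length bs))
      w = c₀ ∷ map proj₁ R
      N : NFA (Column (length bs))
      N = ∃-projection (D ⊗ rowAutomaton md (length bs))
      to : DFA.Accepts (determinise N) w → ∃ λ ρ → ⟦ 𝒜 ⟧ ρ × Admissible md Π ρ × P ρ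
      to acc =
        let (w′ , extends , acc⊗) = Equivalence.to (Projection.Accepts-projection _∷_ padding Entry-finite _ w)
                                                   (Equivalence.to (Accepts-determinise N w) acc)
            (accD , run) = Equivalence.to (Accepts-⊗ D (rowAutomaton md (length bs)) w′) acc⊗
            (ρ , accepted , adm , x₀ , R′ , w′≡ , enc′) = extension⇒trace extends run
        in ρ , accepted , adm , Equivalence.from (P⇔ enc′) (subst (DFA.Accepts D) w′≡ accD)
      from : (∃ λ ρ → ⟦ 𝒜 ⟧ ρ × Admissible md Π ρ × P ρ) → DFA.Accepts (determinise N) w
      from (ρ , accepted , adm , p) =
        let (x₀ , R′ , extends , run , enc′) = trace⇒extension ρ accepted adm
        in Equivalence.from (Accepts-determinise N w)
             (Equivalence.from (Projection.Accepts-projection _∷_ padding Entry-finite _ w)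
               (_ , extends , Equivalence.from (Accepts-⊗ D (rowAutomaton md (length bs)) _) (Equivalence.to (P⇔ enc′) p , run)))

  automaton : Mode → (bs : List Var) → HyperMTL k → DFA (Column (length bs))
  automaton md bs (body ψ)     = determinise (MarkingAutomaton.automaton k bs ψ)
  automaton md bs (Exists π φ) = determinise (∃-projection (automaton md (π ∷ bs) φ ⊗ rowAutomaton md _))
  automaton md bs (Forall π φ) =
    complement (determinise (∃-projection (complement (automaton md (π ∷ bs) φ) ⊗ rowAutomaton md _)))

  automaton-correct : ∀ md bs φ → WellBound bs φ → Untimed φ → ∀ {Π c₀ R} → Encodes md bs Π c₀ R →
                      SatH md ⟦ 𝒜 ⟧ Π φ 0ℚ ⇔ DFA.Accepts (automaton md bs φ) (c₀ ∷ map proj₁ R)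
  automaton-correct md bs (body ψ) _ untimed {c₀ = c₀} {R} enc =
    mk⇔ (Equivalence.from (Accepts-determinise N w) ∘ sat⇒accepts) (accepts⇒sat ∘ Equivalence.to (Accepts-determinise N w))
    where
    open MarkingAutomaton.Language k bs ψ (Encodes.represents enc) (Encodes.sorted enc) untimed
    N : NFA (Column (length bs))
    N = MarkingAutomaton.automaton k bs ψ
    w : List (Column (length bs))
    w = c₀ ∷ map proj₁ R
  automaton-correct md bs (Exists π φ) (π∉ , wb) untimed {Π} enc =
    ⇔.sym (Accepts-∃ md bs π π∉ enc (automaton md (π ∷ bs) φ) (λ ρ → SatH md ⟦ 𝒜 ⟧ (Π [ π ↦ ρ ]) φ 0ℚ)
                     (automaton-correct md (π ∷ bs) φ wb untimed))
  automaton-correct md bs (Forall π φ) (π∉ , wb) untimed {Π} {c₀} {R} enc = mk⇔ to from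
    where
    D : DFA (Column (suc (length bs)))
    D = automaton md (π ∷ bs) φ
    D∃ : DFA (Column (length bs))
    D∃ = determinise (∃-projection (complement D ⊗ rowAutomaton md (length bs)))
    w : List (Column (length bs))
    w = c₀ ∷ map proj₁ R
    IH : ∀ {Π′ c₀′ R′} → Encodes md (π ∷ bs) Π′ c₀′ R′ →
         SatH md ⟦ 𝒜 ⟧ Π′ φ 0ℚ ⇔ DFA.Accepts D (c₀′ ∷ map proj₁ R′)
    IH = automaton-correct md (π ∷ bs) φ wb untimed
    counterexample : DFA.Accepts D∃ w ⇔ (∃ λ ρ → ⟦ 𝒜 ⟧ ρ × Admissible md Π ρ × ¬ SatH md ⟦ 𝒜 ⟧ (Π [ π ↦ ρ ]) φ 0ℚ)
    counterexample = Accepts-∃ md bs π π∉ enc (complement D) (λ ρ → ¬ SatH md ⟦ 𝒜 ⟧ (Π [ π ↦ ρ ]) φ 0ℚ)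
      (λ {_} {x₀} {R′} enc′ → ⇔.trans (¬-⇔ (IH enc′)) (⇔.sym (Accepts-complement D ((x₀ ∷ c₀) ∷ map proj₁ R′))))
    to : SatH md ⟦ 𝒜 ⟧ Π (Forall π φ) 0ℚ → DFA.Accepts (complement D∃) w
    to sat = Equivalence.from (Accepts-complement D∃ w) λ acc →
      let (ρ , accepted , adm , ¬sat) = Equivalence.to counterexample acc in ¬sat (sat ρ accepted adm)
    -- Satisfaction of the body is acceptance by D, hence decidable: no classical reasoning.
    from : DFA.Accepts (complement D∃) w → SatH md ⟦ 𝒜 ⟧ Π (Forall π φ) 0ℚ
    from acc ρ accepted adm =
      let (x₀ , R′ , _ , _ , enc′) = Quantifier.trace⇒extension md bs π π∉ enc ρ accepted adm
      in Equivalence.from (IH enc′) (Dec.decidable-stable (DFA.accepts? D ((x₀ ∷ c₀) ∷ map proj₁ R′)) λ ¬a →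
           Equivalence.to (Accepts-complement D∃ w) acc
             (Equivalence.from counterexample (ρ , accepted , adm , ¬a ∘ Equivalence.to (IH enc′))))

  Encodes-initial : ∀ md → Encodes md [] Π∅ [] []
  Encodes-initial md = record { above = [] ; represents = mkRepresents (λ _ → tt) ; synchronised = no-traces md }
    where
    no-traces : ∀ md → Synchronised md Π∅
    no-traces async = tt
    no-traces sync _ _ (_ , ()) _

  decide : ∀ md φ → Closed φ → Untimed φ → Dec (SatH md ⟦ 𝒜 ⟧ Π∅ φ 0ℚ)
  decide md φ closed untimed =
    Dec.map (⇔.sym (automaton-correct md [] φ closed untimed (Encodes-initial md))) (DFA.accepts? (automaton md [] φ) ([] ∷ []))

proposition1 : ∀ {k m : ℕ} (𝒜 : TA (Letter k) m 0) (φ : HyperMTL k) →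
    Closed φ → Untimed φ →
    Dec (⟦ 𝒜 ⟧ ⊨ φ) × Dec (⟦ 𝒜 ⟧ ⊨sync φ)
proposition1 𝒜 φ closed untimed = decide async φ closed untimed , decide sync φ closed untimed
  where open Traces 𝒜
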